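{- Let $\mu$ and $\pi$ be partitions and let $\lambda$ and $\nu$ be finite sequences of positive integers. Then the sequence with general term $$b_{\lambda,\,\mu+n\cdot\pi}^{\nu+n\cdot|\lambda|\cdot\pi} = \big\langle h_\lambda[s_{\mu+n\cdot\pi}],\ h_{\nu+n\cdot|\lambda|\cdot\pi}\big\rangle,\qquad n\in\mathbb{N},$$ is constant for $n$ sufficiently large.
   Context: For a finite sequence of integers $\alpha=(\alpha_1,\dots,\alpha_k)$, $h_\alpha=h_{\alpha_1}\cdots h_{\alpha_k}$ where $h_r$ is the complete homogeneous symmetric function ($h_0=1$, $h_r=0$ for $r<0$). For a partition $\mu$ and finite sequences of integers $\lambda,\nu$, $b_{\lambda,\mu}^{\nu}=\langle h_\lambda[s_\mu],h_\nu\rangle$, where $s_\mu$ is the Schur function, $f[g]$ is plethysm and $\langle\cdot,\cdot\rangle$ is the Hall inner product. Sequences and partitions are added and multiplied by scalars componentwise, after padding with zeros to a common length. $|\lambda|=\sum_i\lambda_i$. -}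

module Defs where

open import Data.Nat using (ℕ; zero; suc; _+_; _*_; _≤ᵇ_; _<ᵇ_; _≡ᵇ_; _<_)
open import Data.Bool using (Bool; true; false; _∧_)
open import Data.List using (List; []; _∷_; _++_; map; concatMap; filterᵇ; upTo; length; replicate; foldr; concat)
open import Data.Nat.ListAction using (sum)
open import Data.List.Relation.Unary.All using (All)
open import Data.List.Relation.Unary.Linked using (Linked)
open import Data.Nat using (_≥_)
open import Data.Product using (_×_)

_⊕_ : List ℕ → List ℕ → List ℕ
[] ⊕ ys = ys
(x ∷ xs) ⊕ [] = x ∷ xs
(x ∷ xs) ⊕ (y ∷ ys) = (x + y) ∷ (xs ⊕ ys)

_⊙_ : ℕ → List ℕ → List ℕ
n ⊙ xs = map (n *_) xs

size : List ℕ → ℕ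
size = sum

IsPartition : List ℕ → Set
IsPartition μ = Linked _≥_ μ × All (0 <_) μ

Positive : List ℕ → Set
Positive = All (0 <_)

-- Monomial expansions in L variables x_0,…,x_{L-1}.
-- A monomial is represented by its exponent list (length L);
-- a polynomial with ℕ coefficients by a list of monomials (with repetition).

rows : ℕ → ℕ → ℕ → List (List ℕ)
rows L zero lo = [] ∷ []
rows L (suc m) lo = concatMap (λ e → map (e ∷_) (rows L m e)) (filterᵇ (lo ≤ᵇ_) (upTo L))

fillings : ℕ → List ℕ → List (List (List ℕ))
fillings L [] = [] ∷ []
fillings L (m ∷ μ) = concatMap (λ r → map (r ∷_) (fillings L μ)) (rows L m 0)

colStrict : List ℕ → List ℕ → Bool
colStrict _ [] = true
colStrict [] (_ ∷ _) = false
colStrict (a ∷ as) (b ∷ bs) = (a <ᵇ b) ∧ colStrict as bs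

isSSYT : List (List ℕ) → Bool
isSSYT [] = true
isSSYT (r ∷ []) = true
isSSYT (r ∷ r' ∷ t) = colStrict r r' ∧ isSSYT (r' ∷ t)

ssyt : ℕ → List ℕ → List (List (List ℕ))
ssyt L μ = filterᵇ isSSYT (fillings L μ)

countEq : ℕ → List ℕ → ℕ
countEq i xs = length (filterᵇ (_≡ᵇ i) xs)

content : ℕ → List (List ℕ) → List ℕ
content L t = map (λ i → countEq i (concat t)) (upTo L)

schur : ℕ → List ℕ → List (List ℕ)
schur L μ = map (content L) (ssyt L μ)

-- multisets of size r of elements of a list (by position)
multisets : {A : Set} → ℕ → List A → List (List A)
multisets zero _ = [] ∷ []
multisets (suc r) [] = []
multisets (suc r) (a ∷ as) = map (a ∷_) (multisets r (a ∷ as)) ++ multisets (suc r) as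

one : ℕ → List ℕ
one L = replicate L 0

prodMono : ℕ → List (List ℕ) → List ℕ
prodMono L = foldr _⊕_ (one L)

-- plethysm h_r[g] for g = Σ_i x^{m_i} (monomials with multiplicity):
-- h_r[g] = Σ over multisets {i_1,…,i_r} of x^{m_{i_1}}⋯x^{m_{i_r}}
hPleth : ℕ → ℕ → List (List ℕ) → List (List ℕ)
hPleth L r g = map (prodMono L) (multisets r g)

polyMul : List (List ℕ) → List (List ℕ) → List (List ℕ)
polyMul f g = concatMap (λ m → map (m ⊕_) g) f

hλPleth : ℕ → List ℕ → List ℕ → List (List ℕ)
hλPleth L λs μ = foldr (λ r acc → polyMul (hPleth L r (schur L μ)) acc) (one L ∷ []) λs

listEqᵇ : List ℕ → List ℕ → Bool
listEqᵇ [] [] = true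
listEqᵇ (x ∷ xs) (y ∷ ys) = (x ≡ᵇ y) ∧ listEqᵇ xs ys
listEqᵇ _ _ = false

-- b^ν_{λ,μ} = ⟨h_λ[s_μ], h_ν⟩ = coefficient of x^ν in h_λ[s_μ]
-- (computed in L = length ν variables).
b : List ℕ → List ℕ → List ℕ → ℕ
b λs μ ν = length (filterᵇ (listEqᵇ ν) (hλPleth (length ν) λs μ))

{-# OPTIONS --safe #-}

-- b^ν_{λ,μ} counts the families of |λ| monomials of s_μ (multisets of sizes λ_i) whose product
-- is x^ν.  Every monomial x^v of s_μ is dominated by μ, so one that occurs in such a family is
-- "relevant": its partial sums are at least those of ν minus |λ| − 1 times those of μ.  For
-- μ_n = μ + nπ and ν_n = ν + n|λ|π this forces each row of a relevant tableau of shape μ_n to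
-- have at most C = |λ||μ| entries above its index, so for n ≥ C + |μ| row i begins with at
-- least π_i entries i.  Deleting them is a bijection from the relevant tableaux for n + 1 onto
-- those for n that divides each monomial by x^π; the families for n + 1 are thus those for n
-- shifted by π, and the coefficient stays constant.

module Submission where

open import Defs
open import Data.Bool using (Bool; true; false; _∧_; if_then_else_; T)
open import Data.Bool.ListAction using (all)
open import Data.Bool.Properties using (T-∧; T-≡; ∧-identityʳ)
open import Data.Empty using (⊥-elim)
open import Data.List
  using (List; []; _∷_; _++_; map; concatMap; concat; filterᵇ; length; replicate; upTo; applyUpTo; take; drop)
open import Data.List.Properties
  using ( filter-++; filter-accept; filter-reject; filter-all; filter-none; map-∘; map-cong; map-cong-local
        ; map-++; map-id; map-upTo; concatMap-cong; concatMap-map; map-concatMap; ∷-injectiveˡ; ∷-injectiveʳ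
        ; ++-identityʳ; length-++; length-map; length-replicate; length-applyUpTo; applyUpTo-∷ʳ )
open import Data.List.Relation.Unary.All as All using (All; []; _∷_)
open import Data.List.Relation.Unary.All.Properties
  using (++⁺; map⁺; map⁻; concat⁺; filter⁺; all-filter; all-upTo; replicate⁺; all⁻)
open import Data.List.Relation.Unary.Linked using (Linked; _∷_)
open import Data.Nat
open import Data.Nat.ListAction using (sum)
open import Data.Nat.ListAction.Properties using (sum-++)
open import Data.Nat.Properties
open import Data.Nat.Solver using (module +-*-Solver)
open import Algebra.Properties.CommutativeSemigroup +-commutativeSemigroup
  using () renaming (interchange to +-interchange; x∙yz≈y∙xz to +-left-comm)
open import Data.Product using (_×_; _,_; proj₁; proj₂; ∃)
open import Data.Sum using (_⊎_; inj₁; inj₂)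
open import Data.Unit using (⊤; tt)
open import Function using (_∘_; id)
open import Function.Bundles using (Equivalence)
open import Relation.Binary.PropositionalEquality
open import Relation.Nullary using (¬_; yes; no)
open import Relation.Nullary.Decidable using (T?)

private variable
  A B : Set

∧-intro : ∀ {a b} → T a → T b → T (a ∧ b)
∧-intro ta tb = Equivalence.from T-∧ (ta , tb)

∧-elim : ∀ {a b} → T (a ∧ b) → T a × T b
∧-elim = Equivalence.to T-∧

T-ext : ∀ {a b} → (T a → T b) → (T b → T a) → a ≡ b
T-ext {true}  {true}  _ _ = refl
T-ext {true}  {false} f _ = ⊥-elim (f tt)
T-ext {false} {true}  _ g = ⊥-elim (g tt)
T-ext {false} {false} _ _ = refl

filterᵇ-map : ∀ (p : B → Bool) (f : A → B) xs → filterᵇ p (map f xs) ≡ map f (filterᵇ (p ∘ f) xs)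
filterᵇ-map p f [] = refl
filterᵇ-map p f (x ∷ xs) with p (f x)
... | true  = cong (f x ∷_) (filterᵇ-map p f xs)
... | false = filterᵇ-map p f xs

filterᵇ-concatMap : ∀ (p : B → Bool) (f : A → List B) xs →
  filterᵇ p (concatMap f xs) ≡ concatMap (filterᵇ p ∘ f) xs
filterᵇ-concatMap p f [] = refl
filterᵇ-concatMap p f (x ∷ xs) =
  trans (filter-++ (T? ∘ p) (f x) (concatMap f xs)) (cong (filterᵇ p (f x) ++_) (filterᵇ-concatMap p f xs))

filterᵇ-filterᵇ : ∀ (p q : A → Bool) xs → filterᵇ p (filterᵇ q xs) ≡ filterᵇ (λ x → q x ∧ p x) xs
filterᵇ-filterᵇ p q [] = refl
filterᵇ-filterᵇ p q (x ∷ xs) with q x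
... | false = filterᵇ-filterᵇ p q xs
... | true with p x
...   | true  = cong (x ∷_) (filterᵇ-filterᵇ p q xs)
...   | false = filterᵇ-filterᵇ p q xs

filterᵇ-cong-local : ∀ {p q : A → Bool} {xs} → All (λ x → p x ≡ q x) xs → filterᵇ p xs ≡ filterᵇ q xs
filterᵇ-cong-local [] = refl
filterᵇ-cong-local {p = p} {q} {x ∷ _} (px≡qx ∷ eqs) with p x | q x
... | true  | true  = cong (x ∷_) (filterᵇ-cong-local eqs)
... | false | false = filterᵇ-cong-local eqs
filterᵇ-cong-local (() ∷ _) | true  | false
filterᵇ-cong-local (() ∷ _) | false | true

filterᵇ-const-∧ : ∀ b (q : A → Bool) xs → filterᵇ (λ x → b ∧ q x) xs ≡ (if b then filterᵇ q xs else [])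
filterᵇ-const-∧ true  q xs       = refl
filterᵇ-const-∧ false q []       = refl
filterᵇ-const-∧ false q (x ∷ xs) = filterᵇ-const-∧ false q xs

map-if : ∀ (f : A → B) b xs → map f (if b then xs else []) ≡ (if b then map f xs else [])
map-if f true  xs = refl
map-if f false xs = refl

concatMap-if : ∀ (p : A → Bool) (g : A → List B) xs →
  concatMap (λ x → if p x then g x else []) xs ≡ concatMap g (filterᵇ p xs)
concatMap-if p g [] = refl
concatMap-if p g (x ∷ xs) with p x
... | true  = cong (g x ++_) (concatMap-if p g xs)
... | false = concatMap-if p g xs

filterᵇ-concatMap-∷ : ∀ (p : List A → Bool) (f : A → Bool) (g : List A → Bool) (X : A → List (List A)) rs →
  (∀ r t → p (r ∷ t) ≡ (f r ∧ g t)) →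
  filterᵇ p (concatMap (λ r → map (r ∷_) (X r)) rs)
    ≡ concatMap (λ r → map (r ∷_) (filterᵇ g (X r))) (filterᵇ f rs)
filterᵇ-concatMap-∷ p f g X rs split = begin
    filterᵇ p (concatMap (λ r → map (r ∷_) (X r)) rs)
  ≡⟨ filterᵇ-concatMap p (λ r → map (r ∷_) (X r)) rs ⟩
    concatMap (λ r → filterᵇ p (map (r ∷_) (X r))) rs
  ≡⟨ concatMap-cong row rs ⟩
    concatMap (λ r → if f r then map (r ∷_) (filterᵇ g (X r)) else []) rs
  ≡⟨ concatMap-if f (λ r → map (r ∷_) (filterᵇ g (X r))) rs ⟩
    concatMap (λ r → map (r ∷_) (filterᵇ g (X r))) (filterᵇ f rs)
  ∎
  where
  open ≡-Reasoning
  row : ∀ r → filterᵇ p (map (r ∷_) (X r)) ≡ (if f r then map (r ∷_) (filterᵇ g (X r)) else [])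
  row r = begin
      filterᵇ p (map (r ∷_) (X r))
    ≡⟨ filterᵇ-map p (r ∷_) (X r) ⟩
      map (r ∷_) (filterᵇ (p ∘ (r ∷_)) (X r))
    ≡⟨ cong (map (r ∷_)) (filterᵇ-cong-local (All.universal (split r) (X r))) ⟩
      map (r ∷_) (filterᵇ (λ t → f r ∧ g t) (X r))
    ≡⟨ cong (map (r ∷_)) (filterᵇ-const-∧ (f r) g (X r)) ⟩
      map (r ∷_) (if f r then filterᵇ g (X r) else [])
    ≡⟨ map-if (r ∷_) (f r) (filterᵇ g (X r)) ⟩
      (if f r then map (r ∷_) (filterᵇ g (X r)) else [])
    ∎

≤ᵇ-cancelʳ-+ : ∀ x y k → ((x + k) ≤ᵇ (y + k)) ≡ (x ≤ᵇ y)
≤ᵇ-cancelʳ-+ x y k = T-ext (λ le → ≤⇒≤ᵇ (+-cancelʳ-≤ k x y (≤ᵇ⇒≤ (x + k) (y + k) le)))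
                           (λ le → ≤⇒≤ᵇ (+-monoˡ-≤ k (≤ᵇ⇒≤ x y le)))

entry : List ℕ → ℕ → ℕ
entry []       i       = 0
entry (x ∷ xs) zero    = x
entry (x ∷ xs) (suc i) = entry xs i

entry-≥length : ∀ v i → length v ≤ i → entry v i ≡ 0
entry-≥length []      i       _         = refl
entry-≥length (x ∷ v) (suc i) (s≤s len) = entry-≥length v i len

entry-ext : ∀ u w → length u ≡ length w → (∀ i → entry u i ≡ entry w i) → u ≡ w
entry-ext []      []      _   _  = refl
entry-ext (x ∷ u) (y ∷ w) len eq = cong₂ _∷_ (eq 0) (entry-ext u w (suc-injective len) (eq ∘ suc))

entry-replicate-0 : ∀ k i → entry (replicate k 0) i ≡ 0
entry-replicate-0 zero    i       = refl
entry-replicate-0 (suc k) zero    = refl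
entry-replicate-0 (suc k) (suc i) = entry-replicate-0 k i

length-⊕ : ∀ u w → length (u ⊕ w) ≡ length u ⊔ length w
length-⊕ []      w       = refl
length-⊕ (x ∷ u) []      = refl
length-⊕ (x ∷ u) (y ∷ w) = cong suc (length-⊕ u w)

entry-⊕ : ∀ u w i → entry (u ⊕ w) i ≡ entry u i + entry w i
entry-⊕ []      w       i       = refl
entry-⊕ (x ∷ u) []      i       = sym (+-identityʳ _)
entry-⊕ (x ∷ u) (y ∷ w) zero    = refl
entry-⊕ (x ∷ u) (y ∷ w) (suc i) = entry-⊕ u w i

⊕-comm : ∀ u w → u ⊕ w ≡ w ⊕ u
⊕-comm u w = entry-ext _ _
  (trans (length-⊕ u w) (trans (⊔-comm (length u) (length w)) (sym (length-⊕ w u))))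
  (λ i → trans (entry-⊕ u w i) (trans (+-comm (entry u i) (entry w i)) (sym (entry-⊕ w u i))))

⊕-assoc : ∀ u v w → (u ⊕ v) ⊕ w ≡ u ⊕ (v ⊕ w)
⊕-assoc u v w = entry-ext _ _ len ent
  where
  open ≡-Reasoning
  len : length ((u ⊕ v) ⊕ w) ≡ length (u ⊕ (v ⊕ w))
  len = begin
      length ((u ⊕ v) ⊕ w)              ≡⟨ length-⊕ (u ⊕ v) w ⟩
      length (u ⊕ v) ⊔ length w         ≡⟨ cong (_⊔ length w) (length-⊕ u v) ⟩
      (length u ⊔ length v) ⊔ length w  ≡⟨ ⊔-assoc (length u) (length v) (length w) ⟩
      length u ⊔ (length v ⊔ length w)  ≡⟨ cong (length u ⊔_) (length-⊕ v w) ⟨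
      length u ⊔ length (v ⊕ w)         ≡⟨ length-⊕ u (v ⊕ w) ⟨
      length (u ⊕ (v ⊕ w))              ∎
  ent : ∀ i → entry ((u ⊕ v) ⊕ w) i ≡ entry (u ⊕ (v ⊕ w)) i
  ent i = begin
      entry ((u ⊕ v) ⊕ w) i                ≡⟨ entry-⊕ (u ⊕ v) w i ⟩
      entry (u ⊕ v) i + entry w i          ≡⟨ cong (_+ entry w i) (entry-⊕ u v i) ⟩
      entry u i + entry v i + entry w i    ≡⟨ +-assoc (entry u i) (entry v i) (entry w i) ⟩
      entry u i + (entry v i + entry w i)  ≡⟨ cong (entry u i +_) (entry-⊕ v w i) ⟨
      entry u i + entry (v ⊕ w) i          ≡⟨ entry-⊕ u (v ⊕ w) i ⟨
      entry (u ⊕ (v ⊕ w)) i                ∎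

⊕-interchange : ∀ a b c d → (a ⊕ b) ⊕ (c ⊕ d) ≡ (a ⊕ c) ⊕ (b ⊕ d)
⊕-interchange a b c d = begin
    (a ⊕ b) ⊕ (c ⊕ d)  ≡⟨ ⊕-assoc a b (c ⊕ d) ⟩
    a ⊕ (b ⊕ (c ⊕ d))  ≡⟨ cong (a ⊕_) (⊕-assoc b c d) ⟨
    a ⊕ ((b ⊕ c) ⊕ d)  ≡⟨ cong (λ x → a ⊕ (x ⊕ d)) (⊕-comm b c) ⟩
    a ⊕ ((c ⊕ b) ⊕ d)  ≡⟨ cong (a ⊕_) (⊕-assoc c b d) ⟩
    a ⊕ (c ⊕ (b ⊕ d))  ≡⟨ ⊕-assoc a c (b ⊕ d) ⟨
    (a ⊕ c) ⊕ (b ⊕ d)  ∎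
  where open ≡-Reasoning

⊕-cancelˡ : ∀ a u w → length u ≡ length w → a ⊕ u ≡ a ⊕ w → u ≡ w
⊕-cancelˡ a u w len eq = entry-ext u w len λ i → +-cancelˡ-≡ (entry a i) _ _
  (trans (sym (entry-⊕ a u i)) (trans (cong (λ v → entry v i) eq) (entry-⊕ a w i)))

replicate-0-⊕ : ∀ k v → k ≤ length v → replicate k 0 ⊕ v ≡ v
replicate-0-⊕ k v k≤ = entry-ext _ _
  (trans (length-⊕ (replicate k 0) v) (trans (cong (_⊔ length v) (length-replicate k)) (m≤n⇒m⊔n≡n k≤)))
  (λ i → trans (entry-⊕ (replicate k 0) v i) (cong (_+ entry v i) (entry-replicate-0 k i)))

length-⊙ : ∀ c v → length (c ⊙ v) ≡ length v
length-⊙ c v = length-map (c *_) v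

entry-⊙ : ∀ c v i → entry (c ⊙ v) i ≡ c * entry v i
entry-⊙ c []      i       = sym (*-zeroʳ c)
entry-⊙ c (x ∷ v) zero    = refl
entry-⊙ c (x ∷ v) (suc i) = entry-⊙ c v i

0-⊙ : ∀ v → 0 ⊙ v ≡ replicate (length v) 0
0-⊙ []      = refl
0-⊙ (x ∷ v) = cong (0 ∷_) (0-⊙ v)

suc-⊙ : ∀ c v → suc c ⊙ v ≡ v ⊕ (c ⊙ v)
suc-⊙ c []      = refl
suc-⊙ c (x ∷ v) = cong (_ ∷_) (suc-⊙ c v)

+-⊙ : ∀ a c v → (a + c) ⊙ v ≡ (a ⊙ v) ⊕ (c ⊙ v)
+-⊙ a c []      = refl
+-⊙ a c (x ∷ v) = cong₂ _∷_ (*-distribʳ-+ x a c) (+-⊙ a c v)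

entry≤sum : ∀ v i → entry v i ≤ sum v
entry≤sum []      i       = z≤n
entry≤sum (x ∷ v) zero    = m≤m+n x (sum v)
entry≤sum (x ∷ v) (suc i) = ≤-trans (entry≤sum v i) (m≤n+m (sum v) x)

psum : ℕ → List ℕ → ℕ
psum j v = sum (take (suc j) v)

sum-take-⊕ : ∀ k u w → sum (take k (u ⊕ w)) ≡ sum (take k u) + sum (take k w)
sum-take-⊕ zero    u       w       = refl
sum-take-⊕ (suc k) []      w       = refl
sum-take-⊕ (suc k) (x ∷ u) []      = sym (+-identityʳ _)
sum-take-⊕ (suc k) (x ∷ u) (y ∷ w) =
  trans (cong (x + y +_) (sum-take-⊕ k u w)) (+-interchange x y (sum (take k u)) (sum (take k w)))

psum-⊕ : ∀ j u w → psum j (u ⊕ w) ≡ psum j u + psum j w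
psum-⊕ j = sum-take-⊕ (suc j)

sum-take-⊙ : ∀ k c v → sum (take k (c ⊙ v)) ≡ c * sum (take k v)
sum-take-⊙ zero    c v       = sym (*-zeroʳ c)
sum-take-⊙ (suc k) c []      = sym (*-zeroʳ c)
sum-take-⊙ (suc k) c (x ∷ v) = trans (cong (c * x +_) (sum-take-⊙ k c v)) (sym (*-distribˡ-+ c x _))

psum-⊙ : ∀ j c v → psum j (c ⊙ v) ≡ c * psum j v
psum-⊙ j = sum-take-⊙ (suc j)

sum-take≤sum : ∀ k v → sum (take k v) ≤ sum v
sum-take≤sum zero    v       = z≤n
sum-take≤sum (suc k) []      = z≤n
sum-take≤sum (suc k) (x ∷ v) = +-monoʳ-≤ x (sum-take≤sum k v)

psum-replicate-0 : ∀ j L → psum j (replicate L 0) ≡ 0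
psum-replicate-0 j L = go (suc j) L
  where
  go : ∀ k L → sum (take k (replicate L 0)) ≡ 0
  go zero    L       = refl
  go (suc k) zero    = refl
  go (suc k) (suc L) = go k L

listEqᵇ-sound : ∀ u w → T (listEqᵇ u w) → u ≡ w
listEqᵇ-sound []      []      _  = refl
listEqᵇ-sound (x ∷ u) (y ∷ w) eq with ∧-elim {x ≡ᵇ y} eq
... | x≡y , u≡w = cong₂ _∷_ (≡ᵇ⇒≡ x y x≡y) (listEqᵇ-sound u w u≡w)

listEqᵇ-refl : ∀ u → T (listEqᵇ u u)
listEqᵇ-refl []      = tt
listEqᵇ-refl (x ∷ u) = ∧-intro (≡⇒≡ᵇ x x refl) (listEqᵇ-refl u)

listEqᵇ-cong : ∀ u w u′ w′ → (u ≡ w → u′ ≡ w′) → (u′ ≡ w′ → u ≡ w) → listEqᵇ u w ≡ listEqᵇ u′ w′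
listEqᵇ-cong u w u′ w′ f g =
  T-ext (λ eq → complete (f (listEqᵇ-sound u w eq))) (λ eq → complete (g (listEqᵇ-sound u′ w′ eq)))
  where
  complete : ∀ {v v′} → v ≡ v′ → T (listEqᵇ v v′)
  complete {v} refl = listEqᵇ-refl v

listEqᵇ-⊕-cancelˡ : ∀ a u w → length u ≡ length w → listEqᵇ (a ⊕ u) (a ⊕ w) ≡ listEqᵇ u w
listEqᵇ-⊕-cancelˡ a u w len = listEqᵇ-cong (a ⊕ u) (a ⊕ w) u w (⊕-cancelˡ a u w len) (cong (a ⊕_))

-- Plethysm as a sum over families of monomials

families : List ℕ → List A → List (List A)
families []        g = [] ∷ []
families (r ∷ λs) g = concatMap (λ a → map (a ++_) (families λs g)) (multisets r g)

L≤length-prodMono : ∀ L f → L ≤ length (prodMono L f)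
L≤length-prodMono L []      = ≤-reflexive (sym (length-replicate L))
L≤length-prodMono L (x ∷ f) =
  ≤-trans (L≤length-prodMono L f) (≤-trans (m≤n⊔m (length x) _) (≤-reflexive (sym (length-⊕ x (prodMono L f)))))

length-prodMono : ∀ L f → All (λ v → length v ≡ L) f → length (prodMono L f) ≡ L
length-prodMono L []      []           = length-replicate L
length-prodMono L (v ∷ f) (len ∷ lens) =
  trans (length-⊕ v (prodMono L f)) (trans (cong₂ _⊔_ len (length-prodMono L f lens)) (⊔-idem L))

prodMono-++ : ∀ L f f′ → prodMono L (f ++ f′) ≡ prodMono L f ⊕ prodMono L f′
prodMono-++ L []      f′ = sym (replicate-0-⊕ L (prodMono L f′) (L≤length-prodMono L f′))
prodMono-++ L (x ∷ f) f′ = trans (cong (x ⊕_) (prodMono-++ L f f′)) (sym (⊕-assoc x (prodMono L f) (prodMono L f′)))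

hλPleth≡families : ∀ L λs μ → hλPleth L λs μ ≡ map (prodMono L) (families λs (schur L μ))
hλPleth≡families L []        μ = refl
hλPleth≡families L (r ∷ λs) μ = begin
    concatMap (λ m → map (m ⊕_) (hλPleth L λs μ)) (map (prodMono L) M)
  ≡⟨ cong (λ H → concatMap (λ m → map (m ⊕_) H) (map (prodMono L) M)) (hλPleth≡families L λs μ) ⟩
    concatMap (λ m → map (m ⊕_) (map (prodMono L) F)) (map (prodMono L) M)
  ≡⟨ concatMap-map _ (prodMono L) M ⟩
    concatMap (λ a → map (prodMono L a ⊕_) (map (prodMono L) F)) M
  ≡⟨ concatMap-cong prepend M ⟩
    concatMap (λ a → map (prodMono L) (map (a ++_) F)) M
  ≡⟨ map-concatMap (prodMono L) (λ a → map (a ++_) F) M ⟨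
    map (prodMono L) (families (r ∷ λs) (schur L μ))
  ∎
  where
  open ≡-Reasoning
  F = families λs (schur L μ)
  M = multisets r (schur L μ)
  prepend : ∀ a → map (prodMono L a ⊕_) (map (prodMono L) F) ≡ map (prodMono L) (map (a ++_) F)
  prepend a = begin
      map (prodMono L a ⊕_) (map (prodMono L) F)  ≡⟨ map-∘ F ⟨
      map (λ f → prodMono L a ⊕ prodMono L f) F  ≡⟨ map-cong (λ f → prodMono-++ L a f) F ⟨
      map (λ f → prodMono L (a ++ f)) F           ≡⟨ map-∘ F ⟩
      map (prodMono L) (map (a ++_) F)            ∎

b≡count-families : ∀ λs μ ν →
  b λs μ ν ≡ length (filterᵇ (listEqᵇ ν ∘ prodMono (length ν)) (families λs (schur (length ν) μ)))
b≡count-families λs μ ν = begin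
    length (filterᵇ (listEqᵇ ν) (hλPleth L λs μ))
  ≡⟨ cong (length ∘ filterᵇ (listEqᵇ ν)) (hλPleth≡families L λs μ) ⟩
    length (filterᵇ (listEqᵇ ν) (map (prodMono L) F))
  ≡⟨ cong length (filterᵇ-map (listEqᵇ ν) (prodMono L) F) ⟩
    length (map (prodMono L) (filterᵇ (listEqᵇ ν ∘ prodMono L) F))
  ≡⟨ length-map (prodMono L) (filterᵇ (listEqᵇ ν ∘ prodMono L) F) ⟩
    length (filterᵇ (listEqᵇ ν ∘ prodMono L) F)
  ∎
  where
  open ≡-Reasoning
  L = length ν
  F = families λs (schur L μ)

multisets-map : ∀ (f : A → B) r xs → multisets r (map f xs) ≡ map (map f) (multisets r xs)
multisets-map f zero    xs       = refl
multisets-map f (suc r) []       = refl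
multisets-map f (suc r) (a ∷ as) = begin
    map (f a ∷_) (multisets r (map f (a ∷ as))) ++ multisets (suc r) (map f as)
  ≡⟨ cong₂ _++_ (cong (map (f a ∷_)) (multisets-map f r (a ∷ as))) (multisets-map f (suc r) as) ⟩
    map (f a ∷_) (map (map f) (multisets r (a ∷ as))) ++ map (map f) (multisets (suc r) as)
  ≡⟨ cong (_++ _) (trans (sym (map-∘ (multisets r (a ∷ as)))) (map-∘ (multisets r (a ∷ as)))) ⟩
    map (map f) (map (a ∷_) (multisets r (a ∷ as))) ++ map (map f) (multisets (suc r) as)
  ≡⟨ map-++ (map f) (map (a ∷_) (multisets r (a ∷ as))) (multisets (suc r) as) ⟨
    map (map f) (multisets (suc r) (a ∷ as))
  ∎
  where open ≡-Reasoning

multisets-filterᵇ-∷ : ∀ (q : A → Bool) r a as →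
  multisets r (filterᵇ q (a ∷ as)) ≡ filterᵇ (all q) (multisets r (a ∷ as)) →
  multisets (suc r) (filterᵇ q as) ≡ filterᵇ (all q) (multisets (suc r) as) →
  multisets (suc r) (filterᵇ q (a ∷ as)) ≡ filterᵇ (all q) (multisets (suc r) (a ∷ as))
multisets-filterᵇ-∷ q r a as ih ih′ with T? (q a)
... | yes qa = begin
    multisets (suc r) (filterᵇ q (a ∷ as))
  ≡⟨ cong (multisets (suc r)) (filter-accept (T? ∘ q) qa) ⟩
    map (a ∷_) (multisets r (a ∷ filterᵇ q as)) ++ multisets (suc r) (filterᵇ q as)
  ≡⟨ cong₂ (λ X Y → map (a ∷_) X ++ Y) (trans (cong (multisets r) (sym (filter-accept (T? ∘ q) qa))) ih) ih′ ⟩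
    map (a ∷_) (filterᵇ (all q) M) ++ filterᵇ (all q) M′
  ≡⟨ cong (λ X → map (a ∷_) X ++ filterᵇ (all q) M′)
       (filterᵇ-cong-local (All.universal (λ m → cong (_∧ all q m) (sym (Equivalence.to T-≡ qa))) M)) ⟩
    map (a ∷_) (filterᵇ (all q ∘ (a ∷_)) M) ++ filterᵇ (all q) M′
  ≡⟨ cong (_++ filterᵇ (all q) M′) (filterᵇ-map (all q) (a ∷_) M) ⟨
    filterᵇ (all q) (map (a ∷_) M) ++ filterᵇ (all q) M′
  ≡⟨ filter-++ (T? ∘ all q) (map (a ∷_) M) M′ ⟨
    filterᵇ (all q) (map (a ∷_) M ++ M′)
  ∎
  where
  open ≡-Reasoning
  M = multisets r (a ∷ as)
  M′ = multisets (suc r) as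
... | no ¬qa = begin
    multisets (suc r) (filterᵇ q (a ∷ as))
  ≡⟨ cong (multisets (suc r)) (filter-reject (T? ∘ q) ¬qa) ⟩
    multisets (suc r) (filterᵇ q as)
  ≡⟨ ih′ ⟩
    filterᵇ (all q) M′
  ≡⟨ cong (_++ filterᵇ (all q) M′) rejected ⟨
    filterᵇ (all q) (map (a ∷_) M) ++ filterᵇ (all q) M′
  ≡⟨ filter-++ (T? ∘ all q) (map (a ∷_) M) M′ ⟨
    filterᵇ (all q) (map (a ∷_) M ++ M′)
  ∎
  where
  open ≡-Reasoning
  M = multisets r (a ∷ as)
  M′ = multisets (suc r) as
  rejected : filterᵇ (all q) (map (a ∷_) M) ≡ []
  rejected = trans (filterᵇ-map (all q) (a ∷_) M)
    (cong (map (a ∷_)) (filter-none (T? ∘ (all q ∘ (a ∷_))) (All.universal (λ m → ¬qa ∘ proj₁ ∘ ∧-elim) M)))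

multisets-filterᵇ : ∀ (q : A → Bool) r xs → multisets r (filterᵇ q xs) ≡ filterᵇ (all q) (multisets r xs)
multisets-filterᵇ q zero    xs       = refl
multisets-filterᵇ q (suc r) []       = refl
multisets-filterᵇ q (suc r) (a ∷ as) =
  multisets-filterᵇ-∷ q r a as (multisets-filterᵇ q r (a ∷ as)) (multisets-filterᵇ q (suc r) as)

all-++ : ∀ (q : A → Bool) a l → all q (a ++ l) ≡ (all q a ∧ all q l)
all-++ q []      l = refl
all-++ q (x ∷ a) l with q x
... | true  = all-++ q a l
... | false = refl

families-map : ∀ (f : A → B) λs xs → families λs (map f xs) ≡ map (map f) (families λs xs)
families-map f []        xs = refl
families-map f (r ∷ λs) xs = begin
    concatMap (λ a → map (a ++_) (families λs (map f xs))) (multisets r (map f xs))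
  ≡⟨ cong₂ (λ F M → concatMap (λ a → map (a ++_) F) M) (families-map f λs xs) (multisets-map f r xs) ⟩
    concatMap (λ a → map (a ++_) (map (map f) F)) (map (map f) M)
  ≡⟨ concatMap-map _ (map f) M ⟩
    concatMap (λ a → map (map f a ++_) (map (map f) F)) M
  ≡⟨ concatMap-cong prepend M ⟩
    concatMap (λ a → map (map f) (map (a ++_) F)) M
  ≡⟨ map-concatMap (map f) (λ a → map (a ++_) F) M ⟨
    map (map f) (concatMap (λ a → map (a ++_) F) M)
  ∎
  where
  open ≡-Reasoning
  F = families λs xs
  M = multisets r xs
  prepend : ∀ a → map (map f a ++_) (map (map f) F) ≡ map (map f) (map (a ++_) F)
  prepend a = trans (sym (map-∘ F)) (trans (map-cong (λ b → sym (map-++ f a b)) F) (map-∘ F))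

families-filterᵇ : ∀ (q : A → Bool) λs xs → families λs (filterᵇ q xs) ≡ filterᵇ (all q) (families λs xs)
families-filterᵇ q []        xs = refl
families-filterᵇ q (r ∷ λs) xs = begin
    concatMap (λ a → map (a ++_) (families λs (filterᵇ q xs))) (multisets r (filterᵇ q xs))
  ≡⟨ cong₂ (λ F M → concatMap (λ a → map (a ++_) F) M) (families-filterᵇ q λs xs) (multisets-filterᵇ q r xs) ⟩
    concatMap (λ a → map (a ++_) (filterᵇ (all q) F)) (filterᵇ (all q) M)
  ≡⟨ concatMap-if (all q) (λ a → map (a ++_) (filterᵇ (all q) F)) M ⟨
    concatMap (λ a → if all q a then map (a ++_) (filterᵇ (all q) F) else []) M
  ≡⟨ concatMap-cong prepend M ⟩
    concatMap (λ a → filterᵇ (all q) (map (a ++_) F)) M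
  ≡⟨ filterᵇ-concatMap (all q) (λ a → map (a ++_) F) M ⟨
    filterᵇ (all q) (concatMap (λ a → map (a ++_) F) M)
  ∎
  where
  open ≡-Reasoning
  F = families λs xs
  M = multisets r xs
  prepend : ∀ a → (if all q a then map (a ++_) (filterᵇ (all q) F) else []) ≡ filterᵇ (all q) (map (a ++_) F)
  prepend a = sym (begin
      filterᵇ (all q) (map (a ++_) F)
    ≡⟨ filterᵇ-map (all q) (a ++_) F ⟩
      map (a ++_) (filterᵇ (all q ∘ (a ++_)) F)
    ≡⟨ cong (map (a ++_)) (filterᵇ-cong-local (All.universal (all-++ q a) F)) ⟩
      map (a ++_) (filterᵇ (λ l → all q a ∧ all q l) F)
    ≡⟨ cong (map (a ++_)) (filterᵇ-const-∧ (all q a) (all q) F) ⟩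
      map (a ++_) (if all q a then filterᵇ (all q) F else [])
    ≡⟨ map-if (a ++_) (all q a) (filterᵇ (all q) F) ⟩
      (if all q a then map (a ++_) (filterᵇ (all q) F) else [])
    ∎)

multisets-All : ∀ {P : A → Set} r {xs} → All P xs → All (All P) (multisets r xs)
multisets-All zero    _                = [] ∷ []
multisets-All (suc r) {[]}     _        = []
multisets-All (suc r) {a ∷ as} (p ∷ ps) =
  ++⁺ (map⁺ (All.map (p ∷_) (multisets-All r (p ∷ ps)))) (multisets-All (suc r) ps)

multisets-length : ∀ r (xs : List A) → All (λ a → length a ≡ r) (multisets r xs)
multisets-length zero    _        = refl ∷ []
multisets-length (suc r) []       = []
multisets-length (suc r) (a ∷ as) =
  ++⁺ (map⁺ (All.map (cong suc) (multisets-length r (a ∷ as)))) (multisets-length (suc r) as)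

families-All : ∀ {P : A → Set} λs {xs} → All P xs → All (All P) (families λs xs)
families-All []        _  = [] ∷ []
families-All (r ∷ λs) ps =
  concat⁺ (map⁺ (All.map (λ pa → map⁺ (All.map (++⁺ pa) (families-All λs ps))) (multisets-All r ps)))

families-length : ∀ λs (xs : List A) → All (λ a → length a ≡ sum λs) (families λs xs)
families-length []        _  = refl ∷ []
families-length (r ∷ λs) xs = concat⁺ (map⁺ (All.map
  (λ {a} la → map⁺ (All.map (λ lb → trans (length-++ a) (cong₂ _+_ la lb)) (families-length λs xs)))
  (multisets-length r xs)))

families-restrict : ∀ (E : List A → Bool) (R : A → Bool) (D : A → Set) λs g → All D g →
  (∀ f → All D f → length f ≡ sum λs → T (E f) → T (all R f)) →
  filterᵇ E (families λs g) ≡ filterᵇ E (families λs (filterᵇ R g))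
families-restrict E R D λs g Dg E⇒R = begin
    filterᵇ E (families λs g)
  ≡⟨ filterᵇ-cong-local (All.map E≡R∧E (All.zip (families-All λs Dg , families-length λs g))) ⟩
    filterᵇ (λ f → all R f ∧ E f) (families λs g)
  ≡⟨ filterᵇ-filterᵇ E (all R) (families λs g) ⟨
    filterᵇ E (filterᵇ (all R) (families λs g))
  ≡⟨ cong (filterᵇ E) (families-filterᵇ R λs g) ⟨
    filterᵇ E (families λs (filterᵇ R g))
  ∎
  where
  open ≡-Reasoning
  E≡R∧E : ∀ {f} → All D f × length f ≡ sum λs → E f ≡ (all R f ∧ E f)
  E≡R∧E {f} (Df , len) = T-ext (λ e → ∧-intro (E⇒R f Df len e) e) (λ r∧e → proj₂ (∧-elim r∧e))

prodMono-map-⊕ : ∀ L (π : List ℕ) f → length π ≤ L →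
  prodMono L (map (π ⊕_) f) ≡ (length f ⊙ π) ⊕ prodMono L f
prodMono-map-⊕ L π [] π≤L = sym (begin
    (0 ⊙ π) ⊕ one L                   ≡⟨ cong (_⊕ one L) (0-⊙ π) ⟩
    replicate (length π) 0 ⊕ one L    ≡⟨ replicate-0-⊕ (length π) (one L) π≤one ⟩
    one L                              ∎)
  where
  open ≡-Reasoning
  π≤one = ≤-trans π≤L (≤-reflexive (sym (length-replicate L)))
prodMono-map-⊕ L π (x ∷ f) π≤L = begin
    (π ⊕ x) ⊕ prodMono L (map (π ⊕_) f)          ≡⟨ cong ((π ⊕ x) ⊕_) (prodMono-map-⊕ L π f π≤L) ⟩
    (π ⊕ x) ⊕ ((length f ⊙ π) ⊕ prodMono L f)   ≡⟨ ⊕-interchange π x (length f ⊙ π) (prodMono L f) ⟩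
    (π ⊕ (length f ⊙ π)) ⊕ (x ⊕ prodMono L f)   ≡⟨ cong (_⊕ (x ⊕ prodMono L f)) (suc-⊙ (length f) π) ⟨
    (suc (length f) ⊙ π) ⊕ (x ⊕ prodMono L f)   ∎
  where open ≡-Reasoning

data SortedFrom : ℕ → List ℕ → Set where
  []  : ∀ {lo} → SortedFrom lo []
  _∷_ : ∀ {lo x xs} → lo ≤ x → SortedFrom x xs → SortedFrom lo (x ∷ xs)

SortedFrom-weaken : ∀ {lo lo′ r} → lo′ ≤ lo → SortedFrom lo r → SortedFrom lo′ r
SortedFrom-weaken le []       = []
SortedFrom-weaken le (p ∷ sr) = ≤-trans le p ∷ sr

SortedFrom-tail : ∀ {lo x xs} → SortedFrom lo (x ∷ xs) → SortedFrom x xs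
SortedFrom-tail (_ ∷ sr) = sr

SortedFrom-replicate⁺ : ∀ {k r} p → SortedFrom k r → SortedFrom k (replicate p k ++ r)
SortedFrom-replicate⁺ zero    sr = sr
SortedFrom-replicate⁺ (suc p) sr = ≤-refl ∷ SortedFrom-replicate⁺ p sr

SortedFrom-replicate⁻ : ∀ {k r} p → SortedFrom k (replicate p k ++ r) → SortedFrom k r
SortedFrom-replicate⁻ zero    sr       = sr
SortedFrom-replicate⁻ (suc p) (_ ∷ sr) = SortedFrom-replicate⁻ p sr

count≤ : ℕ → List ℕ → ℕ
count≤ v []       = 0
count≤ v (x ∷ xs) with x ≤? v
... | yes _ = suc (count≤ v xs)
... | no  _ = count≤ v xs

count> : ℕ → List ℕ → ℕ
count> v []       = 0
count> v (x ∷ xs) with x ≤? v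
... | yes _ = count> v xs
... | no  _ = suc (count> v xs)

count< : ℕ → List ℕ → ℕ
count< zero    r = 0
count< (suc v) r = count≤ v r

count≤-accept : ∀ {v x} xs → x ≤ v → count≤ v (x ∷ xs) ≡ suc (count≤ v xs)
count≤-accept {v} {x} xs x≤v with x ≤? v
... | yes _   = refl
... | no  x≰v = ⊥-elim (x≰v x≤v)

count≤-reject : ∀ {v x} xs → ¬ x ≤ v → count≤ v (x ∷ xs) ≡ count≤ v xs
count≤-reject {v} {x} xs x≰v with x ≤? v
... | yes x≤v = ⊥-elim (x≰v x≤v)
... | no  _   = refl

count>-reject : ∀ {v x} xs → x ≤ v → count> v (x ∷ xs) ≡ count> v xs
count>-reject {v} {x} xs x≤v with x ≤? v
... | yes _   = refl
... | no  x≰v = ⊥-elim (x≰v x≤v)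

count≤≤length : ∀ v r → count≤ v r ≤ length r
count≤≤length v []      = z≤n
count≤≤length v (x ∷ r) with x ≤? v
... | yes _ = s≤s (count≤≤length v r)
... | no  _ = m≤n⇒m≤1+n (count≤≤length v r)

count≤+count> : ∀ v r → count≤ v r + count> v r ≡ length r
count≤+count> v []      = refl
count≤+count> v (x ∷ r) with x ≤? v
... | yes _ = cong suc (count≤+count> v r)
... | no  _ = trans (+-suc (count≤ v r) (count> v r)) (cong suc (count≤+count> v r))

count≤-mono : ∀ {v w} r → v ≤ w → count≤ v r ≤ count≤ w r
count≤-mono []                v≤w = z≤n
count≤-mono {v} {w} (x ∷ r) v≤w with x ≤? v | x ≤? w
... | yes _   | yes _   = s≤s (count≤-mono r v≤w)
... | yes x≤v | no  x≰w = ⊥-elim (x≰w (≤-trans x≤v v≤w))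
... | no  _   | yes _   = m≤n⇒m≤1+n (count≤-mono r v≤w)
... | no  _   | no  _   = count≤-mono r v≤w

count≤-∷ : ∀ v x r → count≤ v r ≤ count≤ v (x ∷ r)
count≤-∷ v x r with x ≤? v
... | yes _ = n≤1+n _
... | no  _ = ≤-refl

count≤-++ : ∀ v a b → count≤ v (a ++ b) ≡ count≤ v a + count≤ v b
count≤-++ v []      b = refl
count≤-++ v (x ∷ a) b with x ≤? v
... | yes _ = cong suc (count≤-++ v a b)
... | no  _ = count≤-++ v a b

count≤-replicate : ∀ {v k} p r → k ≤ v → count≤ v (replicate p k ++ r) ≡ p + count≤ v r
count≤-replicate zero    r k≤v = refl
count≤-replicate (suc p) r k≤v = trans (count≤-accept _ k≤v) (cong suc (count≤-replicate p r k≤v))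

count>-replicate : ∀ {k} p r → count> k (replicate p k ++ r) ≡ count> k r
count>-replicate zero    r = refl
count>-replicate {k} (suc p) r = trans (count>-reject {k} (replicate p k ++ r) ≤-refl) (count>-replicate p r)

count≤-below : ∀ {lo v r} → SortedFrom lo r → v < lo → count≤ v r ≡ 0
count≤-below []                          _    = refl
count≤-below (lo≤x ∷ sr) v<lo = trans (count≤-reject _ (<⇒≱ v<x)) (count≤-below sr v<x)
  where v<x = <-≤-trans v<lo lo≤x

count<-min : ∀ {lo r} → SortedFrom lo r → count< lo r ≡ 0
count<-min {zero}   sr = refl
count<-min {suc lo} sr = count≤-below sr ≤-refl

count>-above : ∀ {L v} r → All (_< L) r → L ≤ v → count> v r ≡ 0
count>-above []      []         _   = refl
count>-above (x ∷ r) (x<L ∷ r<L) L≤v = trans (count>-reject r (<⇒≤ (<-≤-trans x<L L≤v))) (count>-above r r<L L≤v)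

-- Column strictness through counts

colStrict-∷ : ∀ a b as bs → T (colStrict (a ∷ as) (b ∷ bs)) → a < b × T (colStrict as bs)
colStrict-∷ a b _ _ cs with ∧-elim {a <ᵇ b} cs
... | a<b , cs′ = <ᵇ⇒< a b a<b , cs′

colStrict⇒length≤ : ∀ r r′ → T (colStrict r r′) → length r′ ≤ length r
colStrict⇒length≤ r       []       cs = z≤n
colStrict⇒length≤ (a ∷ r) (b ∷ r′) cs = s≤s (colStrict⇒length≤ r r′ (proj₂ (colStrict-∷ a b r r′ cs)))

colStrict⇒count≤ : ∀ r r′ → T (colStrict r r′) → ∀ v → count≤ v r′ ≤ count< v r
colStrict⇒count≤ r       []       cs v = z≤n
colStrict⇒count≤ (a ∷ r) (b ∷ r′) cs zero with colStrict-∷ a b r r′ cs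
... | a<b , cs′ =
  ≤-trans (≤-reflexive (count≤-reject r′ (<⇒≱ (<-≤-trans (s≤s z≤n) a<b)))) (colStrict⇒count≤ r r′ cs′ zero)
colStrict⇒count≤ (a ∷ r) (b ∷ r′) cs (suc v) with colStrict-∷ a b r r′ cs | b ≤? suc v
... | a<b , cs′ | yes b≤v = ≤-trans (s≤s (colStrict⇒count≤ r r′ cs′ (suc v)))
                                     (≤-reflexive (sym (count≤-accept r (≤-pred (≤-trans a<b b≤v)))))
... | a<b , cs′ | no  b≰v = ≤-trans (colStrict⇒count≤ r r′ cs′ (suc v)) (count≤-∷ v a r)

count≤⇒colStrict : ∀ {a b} r r′ → SortedFrom a r → SortedFrom b r′ → length r′ ≤ length r →
  (∀ v → count≤ v r′ ≤ count< v r) → T (colStrict r r′)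
count≤⇒colStrict r       []       _  _   _   _     = tt
count≤⇒colStrict (x ∷ r) (y ∷ r′) sr sr′ (s≤s len) count = ∧-intro (<⇒<ᵇ x<y)
  (count≤⇒colStrict r r′ (SortedFrom-tail sr) (SortedFrom-tail sr′) len count′)
  where
  x<y : x < y
  x<y with y ≤? x
  ... | no  y≰x = ≰⇒> y≰x
  ... | yes y≤x = ⊥-elim (0≢1+n (sym (n≤0⇒n≡0 (begin
      suc (count≤ x r′)       ≡⟨ count≤-accept r′ y≤x ⟨
      count≤ x (y ∷ r′)       ≤⟨ count x ⟩
      count< x (x ∷ r)        ≡⟨ count<-min (≤-refl ∷ SortedFrom-tail sr) ⟩
      0                       ∎))))
    where open ≤-Reasoning
  count′ : ∀ v → count≤ v r′ ≤ count< v r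
  count′ v with y ≤? v
  ... | no  y≰v = ≤-trans (≤-reflexive (count≤-below (SortedFrom-tail sr′) (≰⇒> y≰v))) z≤n
  ... | yes y≤v with v | y≤v
  ...   | zero   | y≤0  = ⊥-elim (<⇒≱ (<-≤-trans (s≤s z≤n) x<y) y≤0)
  ...   | suc v′ | y≤v′ = ≤-pred (begin
      suc (count≤ (suc v′) r′)  ≡⟨ count≤-accept r′ y≤v′ ⟨
      count≤ (suc v′) (y ∷ r′)  ≤⟨ count (suc v′) ⟩
      count≤ v′ (x ∷ r)         ≡⟨ count≤-accept r (≤-pred (≤-trans x<y y≤v′)) ⟩
      suc (count≤ v′ r)         ∎)
    where open ≤-Reasoning

colStrict-SortedFrom : ∀ {k} r r′ → T (colStrict r r′) → SortedFrom k r → SortedFrom 0 r′ →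
  SortedFrom (suc k) r′
colStrict-SortedFrom r       []       cs _          _   = []
colStrict-SortedFrom (a ∷ r) (b ∷ r′) cs (k≤a ∷ _) sr′ =
  ≤-trans (s≤s k≤a) (proj₁ (colStrict-∷ a b r r′ cs)) ∷ SortedFrom-tail sr′

length-replicate-++ : ∀ p (k : ℕ) r → length (replicate p k ++ r) ≡ p + length r
length-replicate-++ p k r = trans (length-++ (replicate p k)) (cong (_+ length r) (length-replicate p))

colStrict-prefix⁺ : ∀ {k p p′} r r′ → SortedFrom k r → SortedFrom (suc k) r′ → p′ ≤ p →
  T (colStrict r r′) → T (colStrict (replicate p k ++ r) (replicate p′ (suc k) ++ r′))
colStrict-prefix⁺ {k} {p} {p′} r r′ sr sr′ p′≤p cs =
  count≤⇒colStrict (replicate p k ++ r) (replicate p′ (suc k) ++ r′)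
    (SortedFrom-replicate⁺ p sr) (SortedFrom-replicate⁺ p′ sr′) len count
  where
  len : length (replicate p′ (suc k) ++ r′) ≤ length (replicate p k ++ r)
  len = subst₂ _≤_ (sym (length-replicate-++ p′ (suc k) r′)) (sym (length-replicate-++ p k r))
    (+-mono-≤ p′≤p (colStrict⇒length≤ r r′ cs))
  count : ∀ v → count≤ v (replicate p′ (suc k) ++ r′) ≤ count< v (replicate p k ++ r)
  count v with v ≤? k
  ... | yes v≤k = ≤-trans (≤-reflexive (count≤-below (SortedFrom-replicate⁺ p′ sr′) (s≤s v≤k))) z≤n
  ... | no  v≰k with v | ≰⇒> v≰k
  ...   | suc v′ | s≤s k≤v′ =
    subst₂ _≤_ (sym (count≤-replicate p′ r′ (s≤s k≤v′))) (sym (count≤-replicate p r k≤v′))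
      (+-mono-≤ p′≤p (colStrict⇒count≤ r r′ cs (suc v′)))

-- If p′ = p the two prefixes cancel.  If p′ < p, row r is so long that its entries ≤ k alone
-- outnumber the whole of r′.
colStrict-prefix⁻ : ∀ {k p p′ C} r r′ → SortedFrom k r → SortedFrom (suc k) r′ → p′ ≤ p →
  (p′ < p → length r′ + C ≤ length r) → count> k r ≤ C →
  T (colStrict (replicate p k ++ r) (replicate p′ (suc k) ++ r′)) → T (colStrict r r′)
colStrict-prefix⁻ {k} {p} {p′} {C} r r′ sr sr′ p′≤p long few cs = count≤⇒colStrict r r′ sr sr′ len count
  where
  len₀ : p′ + length r′ ≤ p + length r
  len₀ = subst₂ _≤_ (length-replicate-++ p′ (suc k) r′) (length-replicate-++ p k r)
    (colStrict⇒length≤ (replicate p k ++ r) (replicate p′ (suc k) ++ r′) cs)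
  r′≤count : p′ < p → length r′ ≤ count≤ k r
  r′≤count p′<p = +-cancelʳ-≤ C _ _ (begin
      length r′ + C             ≤⟨ long p′<p ⟩
      length r                  ≡⟨ count≤+count> k r ⟨
      count≤ k r + count> k r   ≤⟨ +-monoʳ-≤ (count≤ k r) few ⟩
      count≤ k r + C            ∎)
    where open ≤-Reasoning
  len : length r′ ≤ length r
  len with m≤n⇒m<n∨m≡n p′≤p
  ... | inj₁ p′<p = ≤-trans (r′≤count p′<p) (count≤≤length k r)
  ... | inj₂ refl = +-cancelˡ-≤ p′ _ _ len₀
  count : ∀ v → count≤ v r′ ≤ count< v r
  count v with v ≤? k
  ... | yes v≤k = ≤-trans (≤-reflexive (count≤-below sr′ (s≤s v≤k))) z≤n
  ... | no  v≰k with v | ≰⇒> v≰k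
  ...   | suc v′ | s≤s k≤v′ with m≤n⇒m<n∨m≡n p′≤p
  ...     | inj₂ refl = +-cancelˡ-≤ p′ _ _
    (subst₂ _≤_ (count≤-replicate p′ r′ (s≤s k≤v′)) (count≤-replicate p′ r k≤v′)
      (colStrict⇒count≤ (replicate p′ k ++ r) (replicate p′ (suc k) ++ r′) cs (suc v′)))
  ...     | inj₁ p′<p = ≤-trans (count≤≤length (suc v′) r′) (≤-trans (r′≤count p′<p) (count≤-mono r k≤v′))

prefixRows : ℕ → List ℕ → List (List ℕ) → List (List ℕ)
prefixRows k ps []      = []
prefixRows k ps (r ∷ t) = (replicate (entry ps 0) k ++ r) ∷ prefixRows (suc k) (drop 1 ps) t

entry-drop-1 : ∀ ps i → entry (drop 1 ps) i ≡ entry ps (suc i)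
entry-drop-1 []       i = refl
entry-drop-1 (p ∷ ps) i = refl

RowsFrom : ℕ → List (List ℕ) → Set
RowsFrom k []      = ⊤
RowsFrom k (r ∷ t) = SortedFrom k r × RowsFrom (suc k) t

rowAt : ℕ → List (List ℕ) → List ℕ
rowAt i       []      = []
rowAt zero    (r ∷ t) = r
rowAt (suc i) (r ∷ t) = rowAt i t

-- k + i is the least entry that row i of a tableau in RowsFrom k can hold.
ExcessAtMost : ℕ → ℕ → List (List ℕ) → Set
ExcessAtMost C k t = ∀ i → count> (i + k) (rowAt i t) ≤ C

ExcessAtMost-tail : ∀ {C k r t} → ExcessAtMost C k (r ∷ t) → ExcessAtMost C (suc k) t
ExcessAtMost-tail {C} {k} {r} {t} few i = subst (λ v → count> v (rowAt i t) ≤ C) (sym (+-suc i k)) (few (suc i))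

Antitone : List ℕ → Set
Antitone ps = ∀ i → entry ps (suc i) ≤ entry ps i

Antitone-drop-1 : ∀ ps → Antitone ps → Antitone (drop 1 ps)
Antitone-drop-1 []       _    i = z≤n
Antitone-drop-1 (p ∷ ps) anti i = anti (suc i)

Linked⇒Antitone : ∀ ps → Linked _≥_ ps → Antitone ps
Linked⇒Antitone []           _        i       = z≤n
Linked⇒Antitone (p ∷ [])     _        i       = z≤n
Linked⇒Antitone (p ∷ q ∷ ps) (q≤p ∷ _) zero    = q≤p
Linked⇒Antitone (p ∷ q ∷ ps) (_ ∷ lnk) (suc i) = Linked⇒Antitone (q ∷ ps) lnk i

LongRows : ℕ → List ℕ → List ℕ → Set
LongRows C ps s = ∀ i → (0 < entry ps i → C ≤ entry s i)
                      × (entry ps (suc i) < entry ps i → entry s (suc i) + C ≤ entry s i)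

LongRows-tail : ∀ {C} ps {a s} → LongRows C ps (a ∷ s) → LongRows C (drop 1 ps) s
LongRows-tail {C} ps {a} {s} long i rewrite entry-drop-1 ps i | entry-drop-1 ps (suc i) = long (suc i)

LongRows-⊕⊙ : ∀ C μ π n → C + sum μ ≤ n → LongRows C π (μ ⊕ (n ⊙ π))
LongRows-⊕⊙ C μ π n C+|μ|≤n i = first , second
  where
  open ≤-Reasoning
  entry-s : ∀ i → entry (μ ⊕ (n ⊙ π)) i ≡ entry μ i + n * entry π i
  entry-s i = trans (entry-⊕ μ (n ⊙ π) i) (cong (entry μ i +_) (entry-⊙ n π i))
  n≤n*π : 0 < entry π i → n ≤ n * entry π i
  n≤n*π pos = ≤-trans (≤-reflexive (sym (*-identityʳ n))) (*-monoʳ-≤ n pos)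
  first : 0 < entry π i → C ≤ entry (μ ⊕ (n ⊙ π)) i
  first pos = begin
    C                            ≤⟨ ≤-trans (m≤m+n C (sum μ)) C+|μ|≤n ⟩
    n                            ≤⟨ n≤n*π pos ⟩
    n * entry π i                ≤⟨ m≤n+m _ (entry μ i) ⟩
    entry μ i + n * entry π i    ≡⟨ entry-s i ⟨
    entry (μ ⊕ (n ⊙ π)) i        ∎
  second : entry π (suc i) < entry π i → entry (μ ⊕ (n ⊙ π)) (suc i) + C ≤ entry (μ ⊕ (n ⊙ π)) i
  second π′<π = begin
    entry (μ ⊕ (n ⊙ π)) (suc i) + C                 ≡⟨ cong (_+ C) (entry-s (suc i)) ⟩
    entry μ (suc i) + n * π′ + C                    ≤⟨ +-monoˡ-≤ C (+-monoˡ-≤ (n * π′) (entry≤sum μ (suc i))) ⟩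
    sum μ + n * π′ + C                              ≡⟨ +-comm (sum μ + n * π′) C ⟩
    C + (sum μ + n * π′)                            ≡⟨ +-assoc C (sum μ) (n * π′) ⟨
    C + sum μ + n * π′                              ≤⟨ +-monoˡ-≤ (n * π′) C+|μ|≤n ⟩
    n + n * π′                                      ≡⟨ *-suc n π′ ⟨
    n * suc π′                                      ≤⟨ *-monoʳ-≤ n π′<π ⟩
    n * entry π i                                   ≤⟨ m≤n+m _ (entry μ i) ⟩
    entry μ i + n * entry π i                       ≡⟨ entry-s i ⟨
    entry (μ ⊕ (n ⊙ π)) i                           ∎
    where π′ = entry π (suc i)

isSSYT-∷∷ : ∀ r r′ t → T (isSSYT (r ∷ r′ ∷ t)) → T (colStrict r r′) × T (isSSYT (r′ ∷ t))
isSSYT-∷∷ r r′ t = ∧-elim {colStrict r r′}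

isSSYT-prefixRows⁺ : ∀ k ps t → Antitone ps → RowsFrom k t → T (isSSYT t) → T (isSSYT (prefixRows k ps t))
isSSYT-prefixRows⁺ k ps []           _    _               _  = tt
isSSYT-prefixRows⁺ k ps (r ∷ [])     _    _               _  = tt
isSSYT-prefixRows⁺ k ps (r ∷ r′ ∷ t) anti (sr , sr′ , rf) ss = ∧-intro
  (colStrict-prefix⁺ r r′ sr sr′ (subst (_≤ entry ps 0) (sym (entry-drop-1 ps 0)) (anti 0)) (proj₁ split))
  (isSSYT-prefixRows⁺ (suc k) (drop 1 ps) (r′ ∷ t) (Antitone-drop-1 ps anti) (sr′ , rf) (proj₂ split))
  where split = isSSYT-∷∷ r r′ t ss

isSSYT-prefixRows⁻ : ∀ C k ps t → Antitone ps → RowsFrom k t → LongRows C ps (map length t) → ExcessAtMost C k t →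
  T (isSSYT (prefixRows k ps t)) → T (isSSYT t)
isSSYT-prefixRows⁻ C k ps []           _    _               _    _   _  = tt
isSSYT-prefixRows⁻ C k ps (r ∷ [])     _    _               _    _   _  = tt
isSSYT-prefixRows⁻ C k ps (r ∷ r′ ∷ t) anti (sr , sr′ , rf) long few ss = ∧-intro
  (colStrict-prefix⁻ r r′ sr sr′ p′≤p long₀ (few 0) (proj₁ split))
  (isSSYT-prefixRows⁻ C (suc k) (drop 1 ps) (r′ ∷ t) (Antitone-drop-1 ps anti) (sr′ , rf)
    (LongRows-tail ps long) (ExcessAtMost-tail {C} {k} {r} few) (proj₂ split))
  where
  split = isSSYT-∷∷ (replicate (entry ps 0) k ++ r) (replicate (entry (drop 1 ps) 0) (suc k) ++ r′)
    (prefixRows (suc (suc k)) (drop 1 (drop 1 ps)) t) ss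
  p′≡ : entry (drop 1 ps) 0 ≡ entry ps 1
  p′≡ = entry-drop-1 ps 0
  p′≤p : entry (drop 1 ps) 0 ≤ entry ps 0
  p′≤p = subst (_≤ entry ps 0) (sym p′≡) (anti 0)
  long₀ : entry (drop 1 ps) 0 < entry ps 0 → length r′ + C ≤ length r
  long₀ = subst (λ p′ → p′ < entry ps 0 → length r′ + C ≤ length r) (sym p′≡) (proj₂ (long 0))

isSSYT⇒RowsFrom : ∀ k r t → T (isSSYT (r ∷ t)) → SortedFrom k r → All (SortedFrom 0) t → RowsFrom k (r ∷ t)
isSSYT⇒RowsFrom k r []       _  sr _            = sr , tt
isSSYT⇒RowsFrom k r (r′ ∷ t) ss sr (sr′ ∷ srs) = sr ,
  isSSYT⇒RowsFrom (suc k) r′ t (proj₂ split) (colStrict-SortedFrom r r′ (proj₁ split) sr sr′) srs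
  where split = isSSYT-∷∷ r r′ t ss

SSYT⇒RowsFrom : ∀ t → T (isSSYT t) → All (SortedFrom 0) t → RowsFrom 0 t
SSYT⇒RowsFrom []      _  _          = tt
SSYT⇒RowsFrom (r ∷ t) ss (sr ∷ srs) = isSSYT⇒RowsFrom 0 r t ss sr srs

RowsFrom-prefixRows⁻ : ∀ k ps t → RowsFrom k (prefixRows k ps t) → RowsFrom k t
RowsFrom-prefixRows⁻ k ps []      _         = tt
RowsFrom-prefixRows⁻ k ps (r ∷ t) (sr , rf) =
  SortedFrom-replicate⁻ (entry ps 0) sr , RowsFrom-prefixRows⁻ (suc k) (drop 1 ps) t rf

startsWith : ℕ → ℕ → List ℕ → Bool
startsWith zero    k r       = true
startsWith (suc p) k []      = false
startsWith (suc p) k (x ∷ r) = (x ≡ᵇ k) ∧ startsWith p k r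

HasPrefix : ℕ → List ℕ → List (List ℕ) → Bool
HasPrefix k ps []      = true
HasPrefix k ps (r ∷ t) = startsWith (entry ps 0) k r ∧ HasPrefix (suc k) (drop 1 ps) t

headAtLeast : ℕ → List ℕ → Bool
headAtLeast k []      = true
headAtLeast k (x ∷ _) = k ≤ᵇ x

prefixable : ℕ → ℕ → List ℕ → Bool
prefixable zero    k r = true
prefixable (suc p) k r = headAtLeast k r

Prefixable : ℕ → List ℕ → List (List ℕ) → Bool
Prefixable k ps []      = true
Prefixable k ps (r ∷ t) = prefixable (entry ps 0) k r ∧ Prefixable (suc k) (drop 1 ps) t

addToRows : List ℕ → List ℕ → List ℕ
addToRows []      ps = []
addToRows (a ∷ s) ps = (a + entry ps 0) ∷ addToRows s (drop 1 ps)

addToRows≡⊕ : ∀ s ps → length ps ≤ length s → addToRows s ps ≡ s ⊕ ps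
addToRows≡⊕ []      []       _         = refl
addToRows≡⊕ (a ∷ s) []       _         = cong₂ _∷_ (+-identityʳ a) (addToRows-[] s)
  where
  addToRows-[] : ∀ s → addToRows s [] ≡ s
  addToRows-[] []      = refl
  addToRows-[] (a ∷ s) = cong₂ _∷_ (+-identityʳ a) (addToRows-[] s)
addToRows≡⊕ (a ∷ s) (p ∷ ps) (s≤s len) = cong ((a + p) ∷_) (addToRows≡⊕ s ps len)

startsWith-count≤ : ∀ p k r → SortedFrom k r → p ≤ count≤ k r → T (startsWith p k r)
startsWith-count≤ zero    k r       _          _ = tt
startsWith-count≤ (suc p) k (x ∷ r) (k≤x ∷ sr) p<count with x ≤? k
... | yes x≤k with refl ← ≤-antisym x≤k k≤x =
  ∧-intro (≡⇒≡ᵇ x x refl) (startsWith-count≤ p x r sr (≤-pred p<count))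
... | no  x≰k with () ← subst (suc p ≤_) (count≤-below sr (≰⇒> x≰k)) p<count

-- Row i of a tableau in RowsFrom k starts with its entries ≤ k + i, and a row that is long
-- compared with its at most C larger entries has at least ps_i of them.
HasPrefix-LongRows : ∀ C k ps s t → RowsFrom k t → map length t ≡ addToRows s ps → LongRows C ps s →
  ExcessAtMost C k t → T (HasPrefix k ps t)
HasPrefix-LongRows C k ps s       []      _         _    _    _   = tt
HasPrefix-LongRows C k ps (a ∷ s) (r ∷ t) (sr , rf) lens long few = ∧-intro
  (first (entry ps 0) (proj₁ (long 0)) (∷-injectiveˡ lens))
  (HasPrefix-LongRows C (suc k) (drop 1 ps) s t rf (∷-injectiveʳ lens) (LongRows-tail ps long) (ExcessAtMost-tail few))
  where
  first : ∀ p → (0 < p → C ≤ a) → length r ≡ a + p → T (startsWith p k r)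
  first zero    _    _   = tt
  first (suc p) C≤a len = startsWith-count≤ (suc p) k r sr (+-cancelʳ-≤ (count> k r) _ _ (begin
      suc p + count> k r         ≤⟨ +-monoʳ-≤ (suc p) (≤-trans (few 0) (C≤a (s≤s z≤n))) ⟩
      suc p + a                  ≡⟨ +-comm (suc p) a ⟩
      a + suc p                  ≡⟨ len ⟨
      length r                   ≡⟨ count≤+count> k r ⟨
      count≤ k r + count> k r    ∎))
    where open ≤-Reasoning

Prefixable-RowsFrom : ∀ k ps t → RowsFrom k t → T (Prefixable k ps t)
Prefixable-RowsFrom k ps []      _         = tt
Prefixable-RowsFrom k ps (r ∷ t) (sr , rf) = ∧-intro (first (entry ps 0) r sr) (Prefixable-RowsFrom (suc k) (drop 1 ps) t rf)
  where
  first : ∀ p r → SortedFrom k r → T (prefixable p k r)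
  first zero    r       _         = tt
  first (suc p) []      _         = tt
  first (suc p) (x ∷ r) (k≤x ∷ _) = ≤⇒≤ᵇ k≤x

SortedFrom-prefixRows : ∀ k ps t → T (Prefixable k ps t) → All (SortedFrom 0) t → All (SortedFrom 0) (prefixRows k ps t)
SortedFrom-prefixRows k ps []      _  _          = []
SortedFrom-prefixRows k ps (r ∷ t) pf (sr ∷ srs) with ∧-elim {prefixable (entry ps 0) k r} pf
... | pr , pf′ = first (entry ps 0) pr ∷ SortedFrom-prefixRows (suc k) (drop 1 ps) t pf′ srs
  where
  first : ∀ p → T (prefixable p k r) → SortedFrom 0 (replicate p k ++ r)
  first zero    _  = sr
  first (suc p) pr = SortedFrom-weaken z≤n (SortedFrom-replicate⁺ (suc p) (atLeast r sr pr))
    where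
    atLeast : ∀ r → SortedFrom 0 r → T (headAtLeast k r) → SortedFrom k r
    atLeast []      _  _   = []
    atLeast (x ∷ r) sr k≤x = ≤ᵇ⇒≤ k x k≤x ∷ SortedFrom-tail sr

rows-valid : ∀ L m lo → All (λ r → SortedFrom lo r × All (_< L) r × length r ≡ m) (rows L m lo)
rows-valid L zero    lo = ([] , [] , refl) ∷ []
rows-valid L (suc m) lo = concat⁺ (map⁺ (All.map
  (λ {e} (lo≤e , e<L) → map⁺ (All.map (λ (sr , r<L , len) → lo≤e ∷ sr , e<L ∷ r<L , cong suc len) (rows-valid L m e)))
  (All.zip ( All.map (≤ᵇ⇒≤ lo _) (all-filter (T? ∘ (lo ≤ᵇ_)) (upTo L))
           , filter⁺ (T? ∘ (lo ≤ᵇ_)) (all-upTo L) ))))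

Filling : ℕ → List ℕ → List (List ℕ) → Set
Filling L s t = All (SortedFrom 0) t × All (All (_< L)) t × map length t ≡ s

fillings-valid : ∀ L s → All (Filling L s) (fillings L s)
fillings-valid L []      = ([] , [] , refl) ∷ []
fillings-valid L (m ∷ s) = concat⁺ (map⁺ (All.map
  (λ (sr , r<L , len) →
     map⁺ (All.map (λ (srs , t<L , lens) → sr ∷ srs , r<L ∷ t<L , cong₂ _∷_ len lens) (fillings-valid L s)))
  (rows-valid L m 0)))

filterᵇ-≡ᵇ-upTo : ∀ n k → k < n → filterᵇ (_≡ᵇ k) (upTo n) ≡ k ∷ []
filterᵇ-≡ᵇ-upTo (suc n) k k<1+n = begin
    filterᵇ (_≡ᵇ k) (upTo (suc n))                          ≡⟨ cong (filterᵇ (_≡ᵇ k)) (applyUpTo-∷ʳ id n) ⟨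
    filterᵇ (_≡ᵇ k) (upTo n ++ n ∷ [])                      ≡⟨ filter-++ (T? ∘ (_≡ᵇ k)) (upTo n) (n ∷ []) ⟩
    filterᵇ (_≡ᵇ k) (upTo n) ++ filterᵇ (_≡ᵇ k) (n ∷ [])   ≡⟨ last (m≤n⇒m<n∨m≡n (≤-pred k<1+n)) ⟩
    k ∷ []                                                  ∎
  where
  open ≡-Reasoning
  last : k < n ⊎ k ≡ n → filterᵇ (_≡ᵇ k) (upTo n) ++ filterᵇ (_≡ᵇ k) (n ∷ []) ≡ k ∷ []
  last (inj₁ k<n) = cong₂ _++_ (filterᵇ-≡ᵇ-upTo n k k<n)
    (filter-reject (T? ∘ (_≡ᵇ k)) {n} {[]} (λ n≡k → <-irrefl (sym (≡ᵇ⇒≡ n k n≡k)) k<n))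
  last (inj₂ refl) = cong₂ _++_
    (filter-none (T? ∘ (_≡ᵇ k)) (All.map (λ {i} i<k i≡k → <-irrefl (≡ᵇ⇒≡ i k i≡k) i<k) (all-upTo k)))
    (filter-accept (T? ∘ (_≡ᵇ k)) {k} {[]} (≡⇒≡ᵇ k k refl))

rows-startsWith : ∀ L p lo k m → lo ≤ k → k < L →
  filterᵇ (startsWith (suc p) k) (rows L (suc (p + m)) lo) ≡ map (replicate (suc p) k ++_) (rows L m k)
rows-startsWith L p lo k m lo≤k k<L = begin
    filterᵇ (startsWith (suc p) k) (concatMap (λ e → map (e ∷_) (rows L (p + m) e)) U)
  ≡⟨ filterᵇ-concatMap-∷ (startsWith (suc p) k) (_≡ᵇ k) (startsWith p k) _ U (λ _ _ → refl) ⟩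
    concatMap (λ e → map (e ∷_) (filterᵇ (startsWith p k) (rows L (p + m) e))) (filterᵇ (_≡ᵇ k) U)
  ≡⟨ cong (concatMap (λ e → map (e ∷_) (filterᵇ (startsWith p k) (rows L (p + m) e)))) onlyK ⟩
    map (k ∷_) (filterᵇ (startsWith p k) (rows L (p + m) k)) ++ []
  ≡⟨ ++-identityʳ _ ⟩
    map (k ∷_) (filterᵇ (startsWith p k) (rows L (p + m) k))
  ≡⟨ rest p ⟩
    map (replicate (suc p) k ++_) (rows L m k)
  ∎
  where
  open ≡-Reasoning
  U = filterᵇ (lo ≤ᵇ_) (upTo L)
  onlyK : filterᵇ (_≡ᵇ k) U ≡ k ∷ []
  onlyK = trans (filterᵇ-filterᵇ (_≡ᵇ k) (lo ≤ᵇ_) (upTo L))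
    (trans (filterᵇ-cong-local (All.universal lo≤∧≡ (upTo L))) (filterᵇ-≡ᵇ-upTo L k k<L))
    where
    lo≤∧≡ : ∀ e → ((lo ≤ᵇ e) ∧ (e ≡ᵇ k)) ≡ (e ≡ᵇ k)
    lo≤∧≡ e = T-ext (proj₂ ∘ ∧-elim)
      (λ e≡k → ∧-intro (≤⇒≤ᵇ (subst (lo ≤_) (sym (≡ᵇ⇒≡ e k e≡k)) lo≤k)) e≡k)
  rest : ∀ q → map (k ∷_) (filterᵇ (startsWith q k) (rows L (q + m) k)) ≡ map (replicate (suc q) k ++_) (rows L m k)
  rest zero    = cong (map (k ∷_)) (filter-all (T? ∘ startsWith 0 k) (All.universal (λ _ → tt) (rows L m k)))
  rest (suc q) = trans (cong (map (k ∷_)) (rows-startsWith L q k k m ≤-refl k<L)) (sym (map-∘ (rows L m k)))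

rows-headAtLeast : ∀ L m k → filterᵇ (headAtLeast k) (rows L m 0) ≡ rows L m k
rows-headAtLeast L zero    k = refl
rows-headAtLeast L (suc m) k = begin
    filterᵇ (headAtLeast k) (concatMap (λ e → map (e ∷_) (rows L m e)) U)
  ≡⟨ filterᵇ-concatMap-∷ (headAtLeast k) (k ≤ᵇ_) (λ _ → true) _ U (λ e _ → sym (∧-identityʳ (k ≤ᵇ e))) ⟩
    concatMap (λ e → map (e ∷_) (filterᵇ (λ _ → true) (rows L m e))) (filterᵇ (k ≤ᵇ_) U)
  ≡⟨ concatMap-cong (λ e → cong (map (e ∷_)) (filter-all (T? ∘ (λ _ → true)) (All.universal (λ _ → tt) (rows L m e))))
       (filterᵇ (k ≤ᵇ_) U) ⟩
    concatMap (λ e → map (e ∷_) (rows L m e)) (filterᵇ (k ≤ᵇ_) U)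
  ≡⟨ cong (concatMap (λ e → map (e ∷_) (rows L m e))) (filterᵇ-filterᵇ (k ≤ᵇ_) (0 ≤ᵇ_) (upTo L)) ⟩
    concatMap (λ e → map (e ∷_) (rows L m e)) (filterᵇ (k ≤ᵇ_) (upTo L))
  ∎
  where
  open ≡-Reasoning
  U = filterᵇ (0 ≤ᵇ_) (upTo L)

rows-prefix : ∀ L p k m → (0 < p → k < L) →
  filterᵇ (startsWith p k) (rows L (m + p) 0) ≡ map (replicate p k ++_) (filterᵇ (prefixable p k) (rows L m 0))
rows-prefix L zero k m _ = begin
    filterᵇ (startsWith 0 k) (rows L (m + 0) 0)     ≡⟨ filter-all (T? ∘ startsWith 0 k) (All.universal (λ _ → tt) _) ⟩
    rows L (m + 0) 0                                 ≡⟨ cong (λ n → rows L n 0) (+-identityʳ m) ⟩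
    rows L m 0                                       ≡⟨ map-id (rows L m 0) ⟨
    map id (rows L m 0)                              ≡⟨ cong (map id) (filter-all (T? ∘ prefixable 0 k) (All.universal (λ _ → tt) _)) ⟨
    map id (filterᵇ (prefixable 0 k) (rows L m 0))   ∎
  where open ≡-Reasoning
rows-prefix L (suc p) k m k<L = begin
    filterᵇ (startsWith (suc p) k) (rows L (m + suc p) 0)          ≡⟨ cong (λ n → filterᵇ (startsWith (suc p) k) (rows L n 0)) m+1+p≡ ⟩
    filterᵇ (startsWith (suc p) k) (rows L (suc (p + m)) 0)        ≡⟨ rows-startsWith L p 0 k m z≤n (k<L (s≤s z≤n)) ⟩
    map (replicate (suc p) k ++_) (rows L m k)                     ≡⟨ cong (map (replicate (suc p) k ++_)) (rows-headAtLeast L m k) ⟨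
    map (replicate (suc p) k ++_) (filterᵇ (headAtLeast k) (rows L m 0)) ∎
  where
  open ≡-Reasoning
  m+1+p≡ : m + suc p ≡ suc (p + m)
  m+1+p≡ = trans (+-suc m p) (cong suc (+-comm m p))

-- The prefix of row i consists of entries k + i, which must be valid indices of the L variables.
PrefixBelow : ℕ → ℕ → List ℕ → Set
PrefixBelow L k ps = ∀ i → 0 < entry ps i → k + i < L

entry-pos⇒<length : ∀ ps i → 0 < entry ps i → i < length ps
entry-pos⇒<length (p ∷ ps) zero    _   = s≤s z≤n
entry-pos⇒<length (p ∷ ps) (suc i) pos = s≤s (entry-pos⇒<length ps i pos)

PrefixBelow-length : ∀ L ps → length ps ≤ L → PrefixBelow L 0 ps
PrefixBelow-length L ps ps≤L i pos = <-≤-trans (entry-pos⇒<length ps i pos) ps≤L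

PrefixBelow-head : ∀ {L k} ps → PrefixBelow L k ps → 0 < entry ps 0 → k < L
PrefixBelow-head {L} {k} ps below pos = subst (_< L) (+-identityʳ k) (below 0 pos)

PrefixBelow-drop-1 : ∀ {L k} ps → PrefixBelow L k ps → PrefixBelow L (suc k) (drop 1 ps)
PrefixBelow-drop-1 {L} {k} ps below i pos =
  subst (_< L) (+-suc k i) (below (suc i) (subst (0 <_) (entry-drop-1 ps i) pos))

fillings-HasPrefix : ∀ L k ps s → PrefixBelow L k ps →
  filterᵇ (HasPrefix k ps) (fillings L (addToRows s ps)) ≡ map (prefixRows k ps) (filterᵇ (Prefixable k ps) (fillings L s))
fillings-HasPrefix L k ps []      _ = refl
fillings-HasPrefix L k ps (a ∷ s) below = begin
    filterᵇ (HasPrefix k ps) (concatMap (λ r → map (r ∷_) X′) (rows L (a + p) 0))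
  ≡⟨ filterᵇ-concatMap-∷ (HasPrefix k ps) (startsWith p k) (HasPrefix (suc k) ps′) (λ _ → X′) (rows L (a + p) 0)
       (λ _ _ → refl) ⟩
    concatMap (λ r → map (r ∷_) (filterᵇ (HasPrefix (suc k) ps′) X′)) (filterᵇ (startsWith p k) (rows L (a + p) 0))
  ≡⟨ cong₂ (λ Y Z → concatMap (λ r → map (r ∷_) Y) Z) (fillings-HasPrefix L (suc k) ps′ s (PrefixBelow-drop-1 ps below))
       (rows-prefix L p k a (PrefixBelow-head ps below)) ⟩
    concatMap (λ r → map (r ∷_) Y) (map (replicate p k ++_) R)
  ≡⟨ concatMap-map (λ r → map (r ∷_) Y) (replicate p k ++_) R ⟩
    concatMap (λ r → map ((replicate p k ++ r) ∷_) Y) R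
  ≡⟨ concatMap-cong (λ r → trans (sym (map-∘ _)) (map-∘ _)) R ⟩
    concatMap (λ r → map (prefixRows k ps) (map (r ∷_) (filterᵇ (Prefixable (suc k) ps′) X))) R
  ≡⟨ map-concatMap (prefixRows k ps) (λ r → map (r ∷_) (filterᵇ (Prefixable (suc k) ps′) X)) R ⟨
    map (prefixRows k ps) (concatMap (λ r → map (r ∷_) (filterᵇ (Prefixable (suc k) ps′) X)) R)
  ≡⟨ cong (map (prefixRows k ps))
       (filterᵇ-concatMap-∷ (Prefixable k ps) (prefixable p k) (Prefixable (suc k) ps′) (λ _ → X) (rows L a 0)
         (λ _ _ → refl)) ⟨
    map (prefixRows k ps) (filterᵇ (Prefixable k ps) (fillings L (a ∷ s)))
  ∎
  where
  open ≡-Reasoning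
  p = entry ps 0
  ps′ = drop 1 ps
  X′ = fillings L (addToRows s ps′)
  X = fillings L s
  Y = map (prefixRows (suc k) ps′) (filterᵇ (Prefixable (suc k) ps′) X)
  R = filterᵇ (prefixable p k) (rows L a 0)

-- Contents and dominance

countEq-accept : ∀ {i x} xs → x ≡ i → countEq i (x ∷ xs) ≡ suc (countEq i xs)
countEq-accept {i} {x} xs x≡i = cong length (filter-accept (T? ∘ (_≡ᵇ i)) {x} {xs} (≡⇒≡ᵇ x i x≡i))

countEq-reject : ∀ {i x} xs → x ≢ i → countEq i (x ∷ xs) ≡ countEq i xs
countEq-reject {i} {x} xs x≢i = cong length (filter-reject (T? ∘ (_≡ᵇ i)) {x} {xs} (x≢i ∘ ≡ᵇ⇒≡ x i))

countEq-++ : ∀ i a b → countEq i (a ++ b) ≡ countEq i a + countEq i b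
countEq-++ i a b = trans (cong length (filter-++ (T? ∘ (_≡ᵇ i)) a b)) (length-++ (filterᵇ (_≡ᵇ i) a))

count≤-zero : ∀ xs → count≤ 0 xs ≡ countEq 0 xs
count≤-zero []       = refl
count≤-zero (x ∷ xs) with x ≤? 0
... | yes z≤n = trans (cong suc (count≤-zero xs)) (sym (countEq-accept xs refl))
... | no  x≰0 = trans (count≤-zero xs) (sym (countEq-reject xs (x≰0 ∘ ≤-reflexive)))

count≤-suc : ∀ n xs → count≤ (suc n) xs ≡ count≤ n xs + countEq (suc n) xs
count≤-suc n []       = refl
count≤-suc n (x ∷ xs) with x ≤? n
... | yes x≤n = begin
    count≤ (suc n) (x ∷ xs)                   ≡⟨ count≤-accept xs (m≤n⇒m≤1+n x≤n) ⟩
    suc (count≤ (suc n) xs)                   ≡⟨ cong suc (count≤-suc n xs) ⟩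
    suc (count≤ n xs + countEq (suc n) xs)    ≡⟨ cong (suc (count≤ n xs) +_) (countEq-reject xs (λ x≡1+n → <-irrefl x≡1+n (s≤s x≤n))) ⟨
    suc (count≤ n xs) + countEq (suc n) (x ∷ xs) ∎
  where open ≡-Reasoning
... | no x≰n with x ≟ suc n
...   | yes refl = begin
    count≤ (suc n) (suc n ∷ xs)               ≡⟨ count≤-accept xs ≤-refl ⟩
    suc (count≤ (suc n) xs)                   ≡⟨ cong suc (count≤-suc n xs) ⟩
    suc (count≤ n xs + countEq (suc n) xs)    ≡⟨ +-suc (count≤ n xs) _ ⟨
    count≤ n xs + suc (countEq (suc n) xs)    ≡⟨ cong (count≤ n xs +_) (countEq-accept xs refl) ⟨
    count≤ n xs + countEq (suc n) (suc n ∷ xs) ∎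
  where open ≡-Reasoning
...   | no  x≢1+n = begin
    count≤ (suc n) (x ∷ xs)                   ≡⟨ count≤-reject xs (λ x≤1+n → x≢1+n (≤-antisym x≤1+n (≰⇒> x≰n))) ⟩
    count≤ (suc n) xs                         ≡⟨ count≤-suc n xs ⟩
    count≤ n xs + countEq (suc n) xs          ≡⟨ cong (count≤ n xs +_) (countEq-reject xs x≢1+n) ⟨
    count≤ n xs + countEq (suc n) (x ∷ xs)    ∎
  where open ≡-Reasoning

count<+countEq : ∀ n xs → count< n xs + countEq n xs ≡ count≤ n xs
count<+countEq zero    xs = sym (count≤-zero xs)
count<+countEq (suc n) xs = sym (count≤-suc n xs)

sum-countEq-upTo : ∀ n xs → sum (applyUpTo (λ i → countEq i xs) n) ≡ count< n xs
sum-countEq-upTo zero    xs = refl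
sum-countEq-upTo (suc n) xs = begin
    sum (applyUpTo (λ i → countEq i xs) (suc n))                 ≡⟨ cong sum (applyUpTo-∷ʳ (λ i → countEq i xs) n) ⟨
    sum (applyUpTo (λ i → countEq i xs) n ++ countEq n xs ∷ [])  ≡⟨ sum-++ (applyUpTo (λ i → countEq i xs) n) (countEq n xs ∷ []) ⟩
    sum (applyUpTo (λ i → countEq i xs) n) + (countEq n xs + 0)  ≡⟨ cong₂ _+_ (sum-countEq-upTo n xs) (+-identityʳ _) ⟩
    count< n xs + countEq n xs                                    ≡⟨ count<+countEq n xs ⟩
    count≤ n xs                                                   ∎
  where open ≡-Reasoning

take-applyUpTo : ∀ (f : ℕ → ℕ) k n → k ≤ n → take k (applyUpTo f n) ≡ applyUpTo f k
take-applyUpTo f zero    n       _         = refl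
take-applyUpTo f (suc k) (suc n) (s≤s k≤n) = cong (f 0 ∷_) (take-applyUpTo (f ∘ suc) k n k≤n)

entry-applyUpTo : ∀ (f : ℕ → ℕ) n i → i < n → entry (applyUpTo f n) i ≡ f i
entry-applyUpTo f (suc n) zero    _       = refl
entry-applyUpTo f (suc n) (suc i) (s≤s i<n) = entry-applyUpTo (f ∘ suc) n i i<n

length-content : ∀ L t → length (content L t) ≡ L
length-content L t = trans (length-map _ (upTo L)) (length-applyUpTo id L)

entry-content : ∀ L t i → i < L → entry (content L t) i ≡ countEq i (concat t)
entry-content L t i i<L = trans (cong (λ v → entry v i) (map-upTo (λ i → countEq i (concat t)) L)) (entry-applyUpTo _ L i i<L)

entry-content-≥ : ∀ L t i → L ≤ i → entry (content L t) i ≡ 0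
entry-content-≥ L t i L≤i = entry-≥length (content L t) i (≤-trans (≤-reflexive (length-content L t)) L≤i)

psum-content : ∀ L j t → j < L → psum j (content L t) ≡ count≤ j (concat t)
psum-content L j t j<L = begin
    sum (take (suc j) (content L t))                               ≡⟨ cong (sum ∘ take (suc j)) (map-upTo (λ i → countEq i (concat t)) L) ⟩
    sum (take (suc j) (applyUpTo (λ i → countEq i (concat t)) L))  ≡⟨ cong sum (take-applyUpTo _ (suc j) L j<L) ⟩
    sum (applyUpTo (λ i → countEq i (concat t)) (suc j))           ≡⟨ sum-countEq-upTo (suc j) (concat t) ⟩
    count≤ j (concat t)                                            ∎
  where open ≡-Reasoning

count≤-concat-below : ∀ {k} t → RowsFrom k t → ∀ v → v < k → count≤ v (concat t) ≡ 0
count≤-concat-below []      _         v _   = refl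
count≤-concat-below (r ∷ t) (sr , rf) v v<k =
  trans (count≤-++ v r (concat t)) (cong₂ _+_ (count≤-below sr v<k) (count≤-concat-below t rf v (m≤n⇒m≤1+n v<k)))

-- Entries ≤ k + i of a tableau in RowsFrom k lie in rows 0, …, i; row i also holds its large entries.
rowExcess+count≤≤psum : ∀ k t → RowsFrom k t → ∀ i →
  count> (i + k) (rowAt i t) + count≤ (i + k) (concat t) ≤ psum i (map length t)
rowExcess+count≤≤psum k []      _         i    = z≤n
rowExcess+count≤≤psum k (r ∷ t) (sr , rf) zero = ≤-reflexive (begin
    count> k r + count≤ k (r ++ concat t)               ≡⟨ cong (count> k r +_) (count≤-++ k r (concat t)) ⟩
    count> k r + (count≤ k r + count≤ k (concat t))     ≡⟨ cong (λ c → count> k r + (count≤ k r + c)) (count≤-concat-below t rf k ≤-refl) ⟩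
    count> k r + (count≤ k r + 0)                       ≡⟨ cong (count> k r +_) (+-identityʳ _) ⟩
    count> k r + count≤ k r                             ≡⟨ +-comm (count> k r) (count≤ k r) ⟩
    count≤ k r + count> k r                             ≡⟨ count≤+count> k r ⟩
    length r                                            ≡⟨ +-identityʳ _ ⟨
    length r + 0                                        ∎)
  where open ≡-Reasoning
rowExcess+count≤≤psum k (r ∷ t) (sr , rf) (suc i) = begin
    count> v (rowAt i t) + count≤ v (r ++ concat t)             ≡⟨ cong (count> v (rowAt i t) +_) (count≤-++ v r (concat t)) ⟩
    count> v (rowAt i t) + (count≤ v r + count≤ v (concat t))   ≡⟨ +-left-comm (count> v (rowAt i t)) (count≤ v r) _ ⟩
    count≤ v r + (count> v (rowAt i t) + count≤ v (concat t))   ≤⟨ +-mono-≤ (count≤≤length v r) rest ⟩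
    length r + psum i (map length t)                            ∎
  where
  open ≤-Reasoning
  v = suc i + k
  rest : count> v (rowAt i t) + count≤ v (concat t) ≤ psum i (map length t)
  rest = subst (λ w → count> w (rowAt i t) + count≤ w (concat t) ≤ psum i (map length t)) (+-suc i k)
    (rowExcess+count≤≤psum (suc k) t rf i)

allBelow : ℕ → (ℕ → Bool) → Bool
allBelow zero    p = true
allBelow (suc n) p = allBelow n p ∧ p n

allBelow⁻ : ∀ n p → T (allBelow n p) → ∀ j → j < n → T (p j)
allBelow⁻ (suc n) p all j j<1+n with ∧-elim {allBelow n p} all | m≤n⇒m<n∨m≡n (≤-pred j<1+n)
... | below , _ | inj₁ j<n  = allBelow⁻ n p below j j<n
... | _ , pn    | inj₂ refl = pn

allBelow⁺ : ∀ n p → (∀ j → j < n → T (p j)) → T (allBelow n p)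
allBelow⁺ zero    p _   = tt
allBelow⁺ (suc n) p all = ∧-intro (allBelow⁺ n p (λ j j<n → all j (m≤n⇒m≤1+n j<n))) (all n ≤-refl)

allBelow-cong : ∀ n p q → (∀ j → j < n → p j ≡ q j) → allBelow n p ≡ allBelow n q
allBelow-cong zero    p q _  = refl
allBelow-cong (suc n) p q eq = cong₂ _∧_ (allBelow-cong n p q (λ j j<n → eq j (m≤n⇒m≤1+n j<n))) (eq n ≤-refl)

rowAt-All : ∀ {P : ℕ → Set} i t → All (All P) t → All P (rowAt i t)
rowAt-All i       []      _          = []
rowAt-All zero    (r ∷ t) (pr ∷ _)  = pr
rowAt-All (suc i) (r ∷ t) (_ ∷ prs) = rowAt-All i t prs

Dominated : ℕ → List ℕ → List ℕ → Bool
Dominated L s v = allBelow L (λ j → psum j v ≤ᵇ psum j s)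

-- A monomial x^v of s_s can occur in a family of m + 1 monomials with product x^ν only if
-- every partial sum of v is at least that of ν minus m times that of s.
Relevant : ℕ → List ℕ → List ℕ → ℕ → List ℕ → Bool
Relevant L ν s m v = allBelow L (λ j → psum j ν ≤ᵇ psum j v + m * psum j s)

content-Dominated : ∀ L t → RowsFrom 0 t → T (Dominated L (map length t) (content L t))
content-Dominated L t rf = allBelow⁺ L _ λ j j<L → ≤⇒≤ᵇ (begin
    psum j (content L t)                                   ≡⟨ psum-content L j t j<L ⟩
    count≤ j (concat t)                                    ≡⟨ cong (λ v → count≤ v (concat t)) (+-identityʳ j) ⟨
    count≤ (j + 0) (concat t)                              ≤⟨ m≤n+m _ _ ⟩
    count> (j + 0) (rowAt j t) + count≤ (j + 0) (concat t) ≤⟨ rowExcess+count≤≤psum 0 t rf j ⟩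
    psum j (map length t)                                  ∎)
  where open ≤-Reasoning

Relevant⇒ExcessAtMost : ∀ L ν m C t → RowsFrom 0 t → All (All (_< L)) t → T (Relevant L ν (map length t) m (content L t)) →
  (∀ j → j < L → suc m * psum j (map length t) ≤ C + psum j ν) → ExcessAtMost C 0 t
Relevant⇒ExcessAtMost L ν m C t rf t<L rel bound i with i <? L
... | no  i≮L = ≤-trans (≤-reflexive (count>-above (rowAt i t) (rowAt-All i t t<L) L≤i+0)) z≤n
  where L≤i+0 = ≤-trans (≮⇒≥ i≮L) (≤-reflexive (sym (+-identityʳ i)))
... | yes i<L = +-cancelʳ-≤ (psum i ν) _ _ (begin
    excess + psum i ν                                     ≤⟨ +-monoʳ-≤ excess (≤ᵇ⇒≤ _ _ (allBelow⁻ L _ rel i i<L)) ⟩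
    excess + (psum i (content L t) + m * S)               ≡⟨ cong (λ c → excess + (c + m * S)) (psum-content L i t i<L) ⟩
    excess + (count≤ i (concat t) + m * S)                ≡⟨ cong (λ v → excess + (count≤ v (concat t) + m * S)) (+-identityʳ i) ⟨
    excess + (count≤ (i + 0) (concat t) + m * S)          ≡⟨ +-assoc excess _ _ ⟨
    excess + count≤ (i + 0) (concat t) + m * S            ≤⟨ +-monoˡ-≤ (m * S) (rowExcess+count≤≤psum 0 t rf i) ⟩
    S + m * S                                             ≤⟨ bound i i<L ⟩
    C + psum i ν                                          ∎)
  where
  open ≤-Reasoning
  S = psum i (map length t)
  excess = count> (i + 0) (rowAt i t)

countEq-replicate : ∀ i p k → countEq i (replicate p k) ≡ (if k ≡ᵇ i then p else 0)
countEq-replicate i zero    k with k ≡ᵇ i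
... | true  = refl
... | false = refl
countEq-replicate i (suc p) k with k ≡ᵇ i in k≡ᵇi
... | true  = cong suc (trans (countEq-replicate i p k) (cong (λ b → if b then p else 0) k≡ᵇi))
... | false = trans (countEq-replicate i p k) (cong (λ b → if b then p else 0) k≡ᵇi)

entry-shifted : ∀ k ps i →
  entry (replicate k 0 ++ ps) i ≡ countEq i (replicate (entry ps 0) k) + entry (replicate (suc k) 0 ++ drop 1 ps) i
entry-shifted zero    []       zero    = refl
entry-shifted zero    (p ∷ ps) zero    = trans (sym (+-identityʳ p)) (cong (_+ 0) (sym (countEq-replicate 0 p 0)))
entry-shifted zero    []       (suc i) = refl
entry-shifted zero    (p ∷ ps) (suc i) = cong (_+ entry ps i) (sym (countEq-replicate (suc i) p 0))
entry-shifted (suc k) ps       zero    = sym (cong (_+ 0) (countEq-replicate 0 (entry ps 0) (suc k)))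
entry-shifted (suc k) ps       (suc i) = trans (entry-shifted k ps i)
  (cong (_+ entry (replicate (suc k) 0 ++ drop 1 ps) i)
    (trans (countEq-replicate i (entry ps 0) k) (sym (countEq-replicate (suc i) (entry ps 0) (suc k)))))

countEq-prefixRows : ∀ k ps t i → length ps ≤ length t →
  countEq i (concat (prefixRows k ps t)) ≡ entry (replicate k 0 ++ ps) i + countEq i (concat t)
countEq-prefixRows k []       []      i _ =
  sym (trans (+-identityʳ _) (trans (cong (λ v → entry v i) (++-identityʳ (replicate k 0))) (entry-replicate-0 k i)))
countEq-prefixRows k ps       (r ∷ t) i ps≤ = begin
    countEq i ((replicate (entry ps 0) k ++ r) ++ concat (prefixRows (suc k) (drop 1 ps) t))
  ≡⟨ countEq-++ i (replicate (entry ps 0) k ++ r) _ ⟩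
    countEq i (replicate (entry ps 0) k ++ r) + countEq i (concat (prefixRows (suc k) (drop 1 ps) t))
  ≡⟨ cong₂ _+_ (countEq-++ i (replicate (entry ps 0) k) r) (countEq-prefixRows (suc k) (drop 1 ps) t i (drop-1-≤ ps ps≤)) ⟩
    (countEq i (replicate (entry ps 0) k) + countEq i r) + (entry (replicate (suc k) 0 ++ drop 1 ps) i + countEq i (concat t))
  ≡⟨ +-interchange (countEq i (replicate (entry ps 0) k)) (countEq i r) _ _ ⟩
    (countEq i (replicate (entry ps 0) k) + entry (replicate (suc k) 0 ++ drop 1 ps) i) + (countEq i r + countEq i (concat t))
  ≡⟨ cong₂ _+_ (entry-shifted k ps i) (countEq-++ i r (concat t)) ⟨
    entry (replicate k 0 ++ ps) i + countEq i (r ++ concat t)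
  ∎
  where
  open ≡-Reasoning
  drop-1-≤ : ∀ ps → length ps ≤ suc (length t) → length (drop 1 ps) ≤ length t
  drop-1-≤ []       _         = z≤n
  drop-1-≤ (p ∷ ps) (s≤s len) = len

content-prefixRows : ∀ L ps t → length ps ≤ length t → length ps ≤ L →
  content L (prefixRows 0 ps t) ≡ ps ⊕ content L t
content-prefixRows L ps t ps≤t ps≤L = entry-ext _ _ len ent
  where
  len : length (content L (prefixRows 0 ps t)) ≡ length (ps ⊕ content L t)
  len = trans (length-content L (prefixRows 0 ps t)) (sym (trans (length-⊕ ps (content L t))
    (trans (cong (length ps ⊔_) (length-content L t)) (m≤n⇒m⊔n≡n ps≤L))))
  ent : ∀ i → entry (content L (prefixRows 0 ps t)) i ≡ entry (ps ⊕ content L t) i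
  ent i with i <? L
  ... | yes i<L = trans (entry-content L (prefixRows 0 ps t) i i<L) (trans (countEq-prefixRows 0 ps t i ps≤t)
    (sym (trans (entry-⊕ ps (content L t) i) (cong (entry ps i +_) (entry-content L t i i<L)))))
  ... | no  i≮L = trans (entry-content-≥ L (prefixRows 0 ps t) i L≤i)
    (sym (trans (entry-⊕ ps (content L t) i) (cong₂ _+_ (entry-≥length ps i (≤-trans ps≤L L≤i)) (entry-content-≥ L t i L≤i))))
    where L≤i = ≮⇒≥ i≮L

count>-rowAt-prefixRows : ∀ k ps t i → count> (i + k) (rowAt i (prefixRows k ps t)) ≡ count> (i + k) (rowAt i t)
count>-rowAt-prefixRows k ps []      i       = refl
count>-rowAt-prefixRows k ps (r ∷ t) zero    = count>-replicate (entry ps 0) r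
count>-rowAt-prefixRows k ps (r ∷ t) (suc i) =
  subst (λ v → count> v (rowAt i (prefixRows (suc k) (drop 1 ps) t)) ≡ count> v (rowAt i t)) (+-suc i k)
    (count>-rowAt-prefixRows (suc k) (drop 1 ps) t i)

prefixRows-below : ∀ L k ps t → PrefixBelow L k ps → All (All (_< L)) t → All (All (_< L)) (prefixRows k ps t)
prefixRows-below L k ps []      _     _            = []
prefixRows-below L k ps (r ∷ t) below (r<L ∷ t<L) =
  ++⁺ (prefix (entry ps 0) (PrefixBelow-head ps below)) r<L
    ∷ prefixRows-below L (suc k) (drop 1 ps) t (PrefixBelow-drop-1 ps below) t<L
  where
  prefix : ∀ p → (0 < p → k < L) → All (_< L) (replicate p k)
  prefix zero    _   = []
  prefix (suc p) k<L = replicate⁺ (suc p) (k<L (s≤s z≤n))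

map-length-prefixRows : ∀ k ps t → map length (prefixRows k ps t) ≡ addToRows (map length t) ps
map-length-prefixRows k ps []      = refl
map-length-prefixRows k ps (r ∷ t) = cong₂ _∷_ (trans (length-replicate-++ (entry ps 0) k r) (+-comm (entry ps 0) (length r)))
  (map-length-prefixRows (suc k) (drop 1 ps) t)

-- Relevant tableaux of shape s + π

filterᵇ-schur : ∀ L s (R : List ℕ → Bool) →
  filterᵇ R (schur L s) ≡ map (content L) (filterᵇ (λ t → isSSYT t ∧ R (content L t)) (fillings L s))
filterᵇ-schur L s R = trans (filterᵇ-map R (content L) (filterᵇ isSSYT (fillings L s)))
  (cong (map (content L)) (filterᵇ-filterᵇ (R ∘ content L) isSSYT (fillings L s)))

module _ (L : ℕ) (s π : List ℕ) (C : ℕ) (R R′ : List ℕ → Bool)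
  (anti : Antitone π) (π≤L : length π ≤ L) (long : LongRows C π s)
  (R′-prefixRows : ∀ t → Filling L s t → R′ (content L (prefixRows 0 π t)) ≡ R (content L t))
  (R′-excess : ∀ t′ → RowsFrom 0 t′ → All (All (_< L)) t′ → map length t′ ≡ addToRows s π →
                 T (R′ (content L t′)) → ExcessAtMost C 0 t′)
  where

  relevant-HasPrefix : ∀ {t′} → Filling L (addToRows s π) t′ →
    (isSSYT t′ ∧ R′ (content L t′)) ≡ (HasPrefix 0 π t′ ∧ (isSSYT t′ ∧ R′ (content L t′)))
  relevant-HasPrefix {t′} (srt , t<L , lens) =
    T-ext (λ good → ∧-intro (hasPrefix good) good) (proj₂ ∘ ∧-elim {HasPrefix 0 π t′})
    where
    hasPrefix : T (isSSYT t′ ∧ R′ (content L t′)) → T (HasPrefix 0 π t′)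
    hasPrefix good = HasPrefix-LongRows C 0 π s t′ rf lens long (R′-excess t′ rf t<L lens (proj₂ (∧-elim good)))
      where rf = SSYT⇒RowsFrom t′ (proj₁ (∧-elim good)) srt

  relevant-prefixRows : ∀ {t} → Filling L s t →
    (Prefixable 0 π t ∧ (isSSYT (prefixRows 0 π t) ∧ R′ (content L (prefixRows 0 π t))))
      ≡ (isSSYT t ∧ R (content L t))
  relevant-prefixRows {t} fill@(srt , t<L , lens) = T-ext forth back
    where
    forth : T (Prefixable 0 π t ∧ (isSSYT (prefixRows 0 π t) ∧ R′ (content L (prefixRows 0 π t)))) →
            T (isSSYT t ∧ R (content L t))
    forth good′ = ∧-intro (isSSYT-prefixRows⁻ C 0 π t anti rf (subst (LongRows C π) (sym lens) long) few ss′) r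
      where
      pf = proj₁ (∧-elim {Prefixable 0 π t} good′)
      ss′ = proj₁ (∧-elim {isSSYT (prefixRows 0 π t)} (proj₂ (∧-elim {Prefixable 0 π t} good′)))
      r′ = proj₂ (∧-elim {isSSYT (prefixRows 0 π t)} (proj₂ (∧-elim {Prefixable 0 π t} good′)))
      r : T (R (content L t))
      r = subst T (R′-prefixRows t fill) r′
      rf′ = SSYT⇒RowsFrom (prefixRows 0 π t) ss′ (SortedFrom-prefixRows 0 π t pf srt)
      rf = RowsFrom-prefixRows⁻ 0 π t rf′
      few′ = R′-excess (prefixRows 0 π t) rf′ (prefixRows-below L 0 π t (PrefixBelow-length L π π≤L) t<L)
        (trans (map-length-prefixRows 0 π t) (cong (λ s′ → addToRows s′ π) lens)) r′
      few : ExcessAtMost C 0 t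
      few i = subst (_≤ C) (count>-rowAt-prefixRows 0 π t i) (few′ i)
    back : T (isSSYT t ∧ R (content L t)) →
           T (Prefixable 0 π t ∧ (isSSYT (prefixRows 0 π t) ∧ R′ (content L (prefixRows 0 π t))))
    back good = ∧-intro (Prefixable-RowsFrom 0 π t rf)
      (∧-intro (isSSYT-prefixRows⁺ 0 π t anti rf ss) (subst T (sym (R′-prefixRows t fill)) (proj₂ (∧-elim good))))
      where
      ss = proj₁ (∧-elim good)
      rf = SSYT⇒RowsFrom t ss srt

  relevantSSYT-addToRows :
    filterᵇ (λ t′ → isSSYT t′ ∧ R′ (content L t′)) (fillings L (addToRows s π))
      ≡ map (prefixRows 0 π) (filterᵇ (λ t → isSSYT t ∧ R (content L t)) (fillings L s))
  relevantSSYT-addToRows = begin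
      filterᵇ Good′ F′
    ≡⟨ filterᵇ-cong-local (All.map relevant-HasPrefix (fillings-valid L (addToRows s π))) ⟩
      filterᵇ (λ t′ → HasPrefix 0 π t′ ∧ Good′ t′) F′
    ≡⟨ filterᵇ-filterᵇ Good′ (HasPrefix 0 π) F′ ⟨
      filterᵇ Good′ (filterᵇ (HasPrefix 0 π) F′)
    ≡⟨ cong (filterᵇ Good′) (fillings-HasPrefix L 0 π s (PrefixBelow-length L π π≤L)) ⟩
      filterᵇ Good′ (map (prefixRows 0 π) (filterᵇ (Prefixable 0 π) F))
    ≡⟨ filterᵇ-map Good′ (prefixRows 0 π) (filterᵇ (Prefixable 0 π) F) ⟩
      map (prefixRows 0 π) (filterᵇ (Good′ ∘ prefixRows 0 π) (filterᵇ (Prefixable 0 π) F))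
    ≡⟨ cong (map (prefixRows 0 π)) (filterᵇ-filterᵇ (Good′ ∘ prefixRows 0 π) (Prefixable 0 π) F) ⟩
      map (prefixRows 0 π) (filterᵇ (λ t → Prefixable 0 π t ∧ Good′ (prefixRows 0 π t)) F)
    ≡⟨ cong (map (prefixRows 0 π)) (filterᵇ-cong-local (All.map relevant-prefixRows (fillings-valid L s))) ⟩
      map (prefixRows 0 π) (filterᵇ Good F)
    ∎
    where
    open ≡-Reasoning
    Good Good′ : List (List ℕ) → Bool
    Good t = isSSYT t ∧ R (content L t)
    Good′ t′ = isSSYT t′ ∧ R′ (content L t′)
    F′ = fillings L (addToRows s π)
    F = fillings L s

  filterᵇ-schur-addToRows : length π ≤ length s →
    filterᵇ R′ (schur L (addToRows s π)) ≡ map (π ⊕_) (filterᵇ R (schur L s))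
  filterᵇ-schur-addToRows π≤s = begin
      filterᵇ R′ (schur L (addToRows s π))
    ≡⟨ filterᵇ-schur L (addToRows s π) R′ ⟩
      map (content L) (filterᵇ (λ t′ → isSSYT t′ ∧ R′ (content L t′)) (fillings L (addToRows s π)))
    ≡⟨ cong (map (content L)) relevantSSYT-addToRows ⟩
      map (content L) (map (prefixRows 0 π) (filterᵇ Good F))
    ≡⟨ map-∘ (filterᵇ Good F) ⟨
      map (content L ∘ prefixRows 0 π) (filterᵇ Good F)
    ≡⟨ map-cong-local (All.map content-shift (filter⁺ (T? ∘ Good) (fillings-valid L s))) ⟩
      map ((π ⊕_) ∘ content L) (filterᵇ Good F)
    ≡⟨ map-∘ (filterᵇ Good F) ⟩
      map (π ⊕_) (map (content L) (filterᵇ Good F))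
    ≡⟨ cong (map (π ⊕_)) (filterᵇ-schur L s R) ⟨
      map (π ⊕_) (filterᵇ R (schur L s))
    ∎
    where
    open ≡-Reasoning
    Good : List (List ℕ) → Bool
    Good t = isSSYT t ∧ R (content L t)
    F = fillings L s
    content-shift : ∀ {t} → Filling L s t → content L (prefixRows 0 π t) ≡ π ⊕ content L t
    content-shift {t} (_ , _ , lens) =
      content-prefixRows L π t (≤-trans π≤s (≤-reflexive (trans (cong length (sym lens)) (length-map length t)))) π≤L

psum-prodMono : ∀ j L f → psum j (prodMono L f) ≡ sum (map (psum j) f)
psum-prodMono j L []      = psum-replicate-0 j L
psum-prodMono j L (v ∷ f) = trans (psum-⊕ j v (prodMono L f)) (cong (psum j v +_) (psum-prodMono j L f))

sum≤length*bound : ∀ B xs → All (_≤ B) xs → sum xs ≤ length xs * B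
sum≤length*bound B []       []           = z≤n
sum≤length*bound B (x ∷ xs) (x≤B ∷ xs≤B) = +-mono-≤ x≤B (sum≤length*bound B xs xs≤B)

sum≤element+rest : ∀ B xs → All (_≤ B) xs → All (λ x → sum xs ≤ x + (length xs ∸ 1) * B) xs
sum≤element+rest B []       []           = []
sum≤element+rest B (y ∷ ys) (y≤B ∷ ys≤B) =
  +-monoʳ-≤ y (sum≤length*bound B ys ys≤B) ∷ others ys ys≤B (sum≤element+rest B ys ys≤B)
  where
  others : ∀ ys → All (_≤ B) ys → All (λ x → sum ys ≤ x + (length ys ∸ 1) * B) ys →
    All (λ x → y + sum ys ≤ x + length ys * B) ys
  others []       _ _ = []
  others (z ∷ zs) _ ih = All.map (λ {x} sum≤ → begin
      y + sum (z ∷ zs)               ≤⟨ +-mono-≤ y≤B sum≤ ⟩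
      B + (x + length zs * B)        ≡⟨ +-left-comm B x _ ⟩
      x + length (z ∷ zs) * B        ∎) ih
    where open ≤-Reasoning

prodMono-Relevant : ∀ L ν s m f → length f ≡ suc m → All (λ v → T (Dominated L s v)) f → ν ≡ prodMono L f →
  All (λ v → T (Relevant L ν s m v)) f
prodMono-Relevant L ν s m f len dom ν≡ =
  All.tabulate λ v∈f → allBelow⁺ L _ λ j j<L → ≤⇒≤ᵇ (All.lookup (relevantAt j j<L) v∈f)
  where
  relevantAt : ∀ j → j < L → All (λ v → psum j ν ≤ psum j v + m * psum j s) f
  relevantAt j j<L = map⁻ (subst (λ n → All (λ x → psum j ν ≤ x + n * psum j s) (map (psum j) f)) rest
    (subst (λ σ → All (λ x → σ ≤ x + (length (map (psum j) f) ∸ 1) * psum j s) (map (psum j) f)) total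
      (sum≤element+rest (psum j s) (map (psum j) f)
        (map⁺ (All.map (λ {v} d → ≤ᵇ⇒≤ (psum j v) (psum j s) (allBelow⁻ L _ d j j<L)) dom)))))
    where
    total : sum (map (psum j) f) ≡ psum j ν
    total = trans (sym (psum-prodMono j L f)) (cong (psum j) (sym ν≡))
    rest : length (map (psum j) f) ∸ 1 ≡ m
    rest = cong (_∸ 1) (trans (length-map (psum j) f) len)

-- The stable range

module Stability (μ π ν λs : List ℕ) (m : ℕ) (|λ|≡1+m : sum λs ≡ suc m) (anti : Antitone π) where

  open +-*-Solver

  L : ℕ
  L = length ν ⊔ length π

  shape weight : ℕ → List ℕ
  shape n = μ ⊕ (n ⊙ π)
  weight n = ν ⊕ ((n * sum λs) ⊙ π)

  coeff : ℕ → ℕ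
  coeff n = b λs (shape n) (weight n)

  -- C bounds the excess of the rows of a relevant tableau (shape-bound), and from N on the
  -- rows of the shape are long compared with C (LongRows-⊕⊙).
  C N : ℕ
  C = suc m * sum μ
  N = C + sum μ

  relevant : ℕ → List ℕ → Bool
  relevant n = Relevant L (weight n) (shape n) m

  relevantMonomials : ℕ → List (List ℕ)
  relevantMonomials n = filterᵇ (relevant n) (schur L (shape n))

  count : ℕ → List (List ℕ) → ℕ
  count n X = length (filterᵇ (listEqᵇ (weight n) ∘ prodMono L) (families λs X))

  length-weight : ∀ n → length (weight n) ≡ L
  length-weight n = trans (length-⊕ ν ((n * sum λs) ⊙ π)) (cong (length ν ⊔_) (length-⊙ (n * sum λs) π))

  π≤L : length π ≤ L
  π≤L = m≤n⊔m (length ν) (length π)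

  π≤shape : ∀ n → length π ≤ length (shape n)
  π≤shape n = ≤-trans (≤-reflexive (sym (length-⊙ n π)))
    (≤-trans (m≤n⊔m (length μ) _) (≤-reflexive (sym (length-⊕ μ (n ⊙ π)))))

  psum-shape : ∀ j n → psum j (shape n) ≡ psum j μ + n * psum j π
  psum-shape j n = trans (psum-⊕ j μ (n ⊙ π)) (cong (psum j μ +_) (psum-⊙ j n π))

  psum-weight : ∀ j n → psum j (weight n) ≡ psum j ν + (n * suc m) * psum j π
  psum-weight j n = trans (psum-⊕ j ν _)
    (cong (psum j ν +_) (trans (psum-⊙ j (n * sum λs) π) (cong (λ k → (n * k) * psum j π) |λ|≡1+m)))

  addToRows-shape : ∀ n → addToRows (shape n) π ≡ shape (suc n)
  addToRows-shape n = begin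
    addToRows (shape n) π     ≡⟨ addToRows≡⊕ (shape n) π (π≤shape n) ⟩
    (μ ⊕ (n ⊙ π)) ⊕ π         ≡⟨ ⊕-assoc μ (n ⊙ π) π ⟩
    μ ⊕ ((n ⊙ π) ⊕ π)         ≡⟨ cong (μ ⊕_) (⊕-comm (n ⊙ π) π) ⟩
    μ ⊕ (π ⊕ (n ⊙ π))         ≡⟨ cong (μ ⊕_) (suc-⊙ n π) ⟨
    shape (suc n)             ∎
    where open ≡-Reasoning

  weight-suc : ∀ n → weight (suc n) ≡ (sum λs ⊙ π) ⊕ weight n
  weight-suc n = begin
    ν ⊕ ((sum λs + n * sum λs) ⊙ π)               ≡⟨ cong (ν ⊕_) (+-⊙ (sum λs) (n * sum λs) π) ⟩
    ν ⊕ ((sum λs ⊙ π) ⊕ ((n * sum λs) ⊙ π))       ≡⟨ ⊕-assoc ν _ _ ⟨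
    (ν ⊕ (sum λs ⊙ π)) ⊕ ((n * sum λs) ⊙ π)       ≡⟨ cong (_⊕ ((n * sum λs) ⊙ π)) (⊕-comm ν (sum λs ⊙ π)) ⟩
    ((sum λs ⊙ π) ⊕ ν) ⊕ ((n * sum λs) ⊙ π)       ≡⟨ ⊕-assoc (sum λs ⊙ π) ν _ ⟩
    (sum λs ⊙ π) ⊕ weight n                       ∎
    where open ≡-Reasoning

  schur-Dominated : ∀ n → All (λ v → T (Dominated L (shape n) v) × length v ≡ L) (schur L (shape n))
  schur-Dominated n = map⁺ (All.map dominated
    (All.zip (all-filter (T? ∘ isSSYT) (fillings L (shape n)) , filter⁺ (T? ∘ isSSYT) (fillings-valid L (shape n)))))
    where
    dominated : ∀ {t} → T (isSSYT t) × Filling L (shape n) t →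
                T (Dominated L (shape n) (content L t)) × length (content L t) ≡ L
    dominated {t} (ss , srt , _ , lens) =
        subst (λ s → T (Dominated L s (content L t))) lens (content-Dominated L t (SSYT⇒RowsFrom t ss srt))
      , length-content L t

  coeff≡count : ∀ n → coeff n ≡ count n (relevantMonomials n)
  coeff≡count n = begin
      coeff n
    ≡⟨ b≡count-families λs (shape n) (weight n) ⟩
      length (filterᵇ (listEqᵇ (weight n) ∘ prodMono (length (weight n))) (families λs (schur (length (weight n)) (shape n))))
    ≡⟨ cong (λ L′ → length (filterᵇ (listEqᵇ (weight n) ∘ prodMono L′) (families λs (schur L′ (shape n))))) (length-weight n) ⟩
      count n (schur L (shape n))
    ≡⟨ cong length (families-restrict (listEqᵇ (weight n) ∘ prodMono L) (relevant n) _ λs (schur L (shape n))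
         (schur-Dominated n) onlyRelevant) ⟩
      count n (relevantMonomials n)
    ∎
    where
    open ≡-Reasoning
    onlyRelevant : ∀ f → All (λ v → T (Dominated L (shape n) v) × length v ≡ L) f → length f ≡ sum λs →
      T (listEqᵇ (weight n) (prodMono L f)) → T (all (relevant n) f)
    onlyRelevant f dom len eq = all⁻ (relevant n) (prodMono-Relevant L (weight n) (shape n) m f
      (trans len |λ|≡1+m) (All.map proj₁ dom) (listEqᵇ-sound (weight n) (prodMono L f) eq))

  relevant-shift : ∀ n c → relevant (suc n) (π ⊕ c) ≡ relevant n c
  relevant-shift n c = allBelow-cong L _ _ λ j _ → begin
      psum j (weight (suc n)) ≤ᵇ psum j (π ⊕ c) + m * psum j (shape (suc n))
    ≡⟨ cong₂ _≤ᵇ_ (lhs j) (rhs j) ⟩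
      (psum j (weight n) + suc m * psum j π) ≤ᵇ (psum j c + m * psum j (shape n) + suc m * psum j π)
    ≡⟨ ≤ᵇ-cancelʳ-+ (psum j (weight n)) (psum j c + m * psum j (shape n)) (suc m * psum j π) ⟩
      psum j (weight n) ≤ᵇ psum j c + m * psum j (shape n)
    ∎
    where
    open ≡-Reasoning
    lhs : ∀ j → psum j (weight (suc n)) ≡ psum j (weight n) + suc m * psum j π
    lhs j = trans (cong (psum j) (weight-suc n)) (trans (psum-⊕ j (sum λs ⊙ π) (weight n))
      (trans (cong (_+ psum j (weight n)) (trans (psum-⊙ j (sum λs) π) (cong (_* psum j π) |λ|≡1+m)))
        (+-comm (suc m * psum j π) (psum j (weight n)))))
    rhs : ∀ j → psum j (π ⊕ c) + m * psum j (shape (suc n)) ≡ psum j c + m * psum j (shape n) + suc m * psum j π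
    rhs j = begin
        psum j (π ⊕ c) + m * psum j (shape (suc n))
      ≡⟨ cong₂ (λ x y → x + m * y) (psum-⊕ j π c) (psum-shape j (suc n)) ⟩
        psum j π + psum j c + m * (psum j μ + suc n * psum j π)
      ≡⟨ solve 5 (λ p c u n m → p :+ c :+ m :* (u :+ (con 1 :+ n) :* p) := c :+ m :* (u :+ n :* p) :+ (con 1 :+ m) :* p)
           refl (psum j π) (psum j c) (psum j μ) n m ⟩
        psum j c + m * (psum j μ + n * psum j π) + suc m * psum j π
      ≡⟨ cong (λ y → psum j c + m * y + suc m * psum j π) (psum-shape j n) ⟨
        psum j c + m * psum j (shape n) + suc m * psum j π
      ∎

  shape-bound : ∀ n j → suc m * psum j (shape n) ≤ C + psum j (weight n)
  shape-bound n j = begin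
      suc m * psum j (shape n)
    ≡⟨ cong (suc m *_) (psum-shape j n) ⟩
      suc m * (psum j μ + n * psum j π)
    ≡⟨ solve 4 (λ m u n p → (con 1 :+ m) :* (u :+ n :* p) := (con 1 :+ m) :* u :+ (n :* (con 1 :+ m)) :* p)
         refl m (psum j μ) n (psum j π) ⟩
      suc m * psum j μ + (n * suc m) * psum j π
    ≤⟨ +-mono-≤ (*-monoʳ-≤ (suc m) (sum-take≤sum (suc j) μ)) (m≤n+m _ (psum j ν)) ⟩
      C + (psum j ν + (n * suc m) * psum j π)
    ≡⟨ cong (C +_) (psum-weight j n) ⟨
      C + psum j (weight n)
    ∎
    where open ≤-Reasoning

  relevantMonomials-suc : ∀ n → N ≤ n → relevantMonomials (suc n) ≡ map (π ⊕_) (relevantMonomials n)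
  relevantMonomials-suc n N≤n = begin
      filterᵇ (relevant (suc n)) (schur L (shape (suc n)))
    ≡⟨ cong (filterᵇ (relevant (suc n)) ∘ schur L) (addToRows-shape n) ⟨
      filterᵇ (relevant (suc n)) (schur L (addToRows (shape n) π))
    ≡⟨ filterᵇ-schur-addToRows L (shape n) π C (relevant n) (relevant (suc n)) anti π≤L
         (LongRows-⊕⊙ C μ π n N≤n) prefixed excess (π≤shape n) ⟩
      map (π ⊕_) (relevantMonomials n)
    ∎
    where
    open ≡-Reasoning
    prefixed : ∀ t → Filling L (shape n) t → relevant (suc n) (content L (prefixRows 0 π t)) ≡ relevant n (content L t)
    prefixed t (_ , _ , lens) =
      trans (cong (relevant (suc n)) (content-prefixRows L π t π≤t π≤L)) (relevant-shift n (content L t))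
      where π≤t = ≤-trans (π≤shape n) (≤-reflexive (trans (cong length (sym lens)) (length-map length t)))
    excess : ∀ t′ → RowsFrom 0 t′ → All (All (_< L)) t′ → map length t′ ≡ addToRows (shape n) π →
      T (relevant (suc n) (content L t′)) → ExcessAtMost C 0 t′
    excess t′ rf t<L lens rel = Relevant⇒ExcessAtMost L (weight (suc n)) m C t′ rf t<L
      (subst (λ σ → T (Relevant L (weight (suc n)) σ m (content L t′))) (sym lens′) rel)
      (λ j _ → subst (λ σ → suc m * psum j σ ≤ C + psum j (weight (suc n))) (sym lens′) (shape-bound (suc n) j))
      where lens′ = trans lens (addToRows-shape n)

  count-shift : ∀ n X → All (λ v → length v ≡ L) X → count (suc n) (map (π ⊕_) X) ≡ count n X
  count-shift n X lens = begin
      length (filterᵇ (E (suc n)) (families λs (map (π ⊕_) X)))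
    ≡⟨ cong (length ∘ filterᵇ (E (suc n))) (families-map (π ⊕_) λs X) ⟩
      length (filterᵇ (E (suc n)) (map (map (π ⊕_)) (families λs X)))
    ≡⟨ cong length (filterᵇ-map (E (suc n)) (map (π ⊕_)) (families λs X)) ⟩
      length (map (map (π ⊕_)) (filterᵇ (E (suc n) ∘ map (π ⊕_)) (families λs X)))
    ≡⟨ length-map (map (π ⊕_)) (filterᵇ (E (suc n) ∘ map (π ⊕_)) (families λs X)) ⟩
      length (filterᵇ (E (suc n) ∘ map (π ⊕_)) (families λs X))
    ≡⟨ cong length (filterᵇ-cong-local (All.map shifted (All.zip (families-All λs lens , families-length λs X)))) ⟩
      length (filterᵇ (E n) (families λs X))
    ∎
    where
    open ≡-Reasoning
    E : ℕ → List (List ℕ) → Bool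
    E n = listEqᵇ (weight n) ∘ prodMono L
    shifted : ∀ {f} → All (λ v → length v ≡ L) f × length f ≡ sum λs → E (suc n) (map (π ⊕_) f) ≡ E n f
    shifted {f} (lens , len) = begin
        listEqᵇ (weight (suc n)) (prodMono L (map (π ⊕_) f))
      ≡⟨ cong₂ listEqᵇ (weight-suc n)
           (trans (prodMono-map-⊕ L π f π≤L) (cong (λ k → (k ⊙ π) ⊕ prodMono L f) len)) ⟩
        listEqᵇ ((sum λs ⊙ π) ⊕ weight n) ((sum λs ⊙ π) ⊕ prodMono L f)
      ≡⟨ listEqᵇ-⊕-cancelˡ (sum λs ⊙ π) (weight n) (prodMono L f)
           (trans (length-weight n) (sym (length-prodMono L f lens))) ⟩
        listEqᵇ (weight n) (prodMono L f)
      ∎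

  coeff-suc : ∀ n → N ≤ n → coeff (suc n) ≡ coeff n
  coeff-suc n N≤n = begin
    coeff (suc n)                                       ≡⟨ coeff≡count (suc n) ⟩
    count (suc n) (relevantMonomials (suc n))           ≡⟨ cong (count (suc n)) (relevantMonomials-suc n N≤n) ⟩
    count (suc n) (map (π ⊕_) (relevantMonomials n))    ≡⟨ count-shift n _ lengths ⟩
    count n (relevantMonomials n)                       ≡⟨ coeff≡count n ⟨
    coeff n                                             ∎
    where
    open ≡-Reasoning
    lengths = All.map proj₂ (filter⁺ (T? ∘ relevant n) (schur-Dominated n))

  coeff-stable : ∀ n → N ≤ n → coeff n ≡ coeff N
  coeff-stable n N≤n = go (≤⇒≤′ N≤n)
    where
    go : ∀ {n} → N ≤′ n → coeff n ≡ coeff N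
    go ≤′-refl            = refl
    go (≤′-step {n} N≤′n) = trans (coeff-suc n (≤′⇒≤ N≤′n)) (go N≤′n)

-- For λ = () the coefficient does not depend on
-- the shape, and the weight does not depend on n.
theorem3p4 : (μ π λs ν : List ℕ) → IsPartition μ → IsPartition π → Positive λs → Positive ν →
    ∃ λ N → ∀ n → N ≤ n →
    b λs (μ ⊕ (n ⊙ π)) (ν ⊕ ((n * size λs) ⊙ π)) ≡ b λs (μ ⊕ (N ⊙ π)) (ν ⊕ ((N * size λs) ⊙ π))
theorem3p4 μ π []            ν _ _          _        _ =
  0 , λ n _ → cong (λ k → b [] (μ ⊕ (n ⊙ π)) (ν ⊕ (k ⊙ π))) (*-zeroʳ n)
theorem3p4 μ π (zero ∷ λs)   ν _ _          (() ∷ _) _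
theorem3p4 μ π (suc r ∷ λs)  ν _ (π-dec , _) _       _ = N , coeff-stable
  where open Stability μ π ν (suc r ∷ λs) (r + sum λs) refl (Linked⇒Antitone π π-dec)
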